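{- Let $\{X_\alpha\}$ be a deconcatenation basis, and let $f, g \colon \mathrm{Comp}_{>0} \to \mathbbm{k}$ be nonsingular functions satisfying $X_\alpha = \sum_{\beta \ge \alpha} f(\alpha, \beta) M_\beta$ and $M_\alpha = \sum_{\beta \ge \alpha} g(\alpha, \beta) X_\beta$. Then the following are equivalent: (i) $\{X_\alpha\}$ is a shuffle basis. (ii) $f^\mathrm{Sh}$ is a character of $\mathrm{Sh}$. (iii) $g^\mathrm{QSym}$ is an infinitesimal character of $\mathrm{QSym}$.
   Context: Work over a field $\mathbbm{k}$. A composition is a finite sequence of positive integers; $\mathrm{Comp}_{>0}$ is the set of nonempty compositions. For compositions with $|\alpha|=|\beta|$, $\alpha\le\beta$ means $\alpha=\alpha^{(1)}\cdots\alpha^{(\ell(\beta))}$ (concatenation) with $\alpha^{(i)}$ a composition of $\beta_i$. For $f\colon\mathrm{Comp}_{>0}\to\mathbbm{k}$ and $\alpha\le\beta$, $f(\alpha,\beta)=f(\alpha^{(1)})\cdots f(\alpha^{(\ell(\beta))})$ (with $f(\emptyset,\emptyset)=1$); $f$ is nonsingular if $f(n)\ne0$ for all positive integers $n$. $\{M_\alpha\}$ is the monomial basis of the Hopf algebra $\mathrm{QSym}$ of quasisymmetric functions. A deconcatenation basis of $\mathrm{QSym}$ is a graded basis $\{D_\alpha\}$ with $\Delta(D_\gamma)=\sum_{\alpha\beta=\gamma}D_\alpha\otimes D_\beta$. For compositions $\alpha,\beta$, $\alpha \sqcup\!\sqcup \beta$ denotes the multiset of all compositions of length $\ell(\alpha)+\ell(\beta)$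 containing $\alpha,\beta$ as disjoint subsequences, with multiplicity. A shuffle basis is a deconcatenation basis $\{X_\alpha\}$ which also satisfies $X_\alpha X_\beta=\sum_{\gamma\in\alpha \sqcup\!\sqcup \beta}X_\gamma$. The shuffle algebra $\mathrm{Sh}$ has basis $\{x_\alpha\}$ over compositions with product $x_\alpha x_\beta=\sum_{\gamma\in\alpha \sqcup\!\sqcup \beta}x_\gamma$ and deconcatenation coproduct. $f^\mathrm{Sh}\colon\mathrm{Sh}\to\mathbbm{k}$ is the linear map with $f^\mathrm{Sh}(x_\emptyset)=1$, $f^\mathrm{Sh}(x_\alpha)=f(\alpha)$ for $\alpha\ne\emptyset$; $g^\mathrm{QSym}\colon\mathrm{QSym}\to\mathbbm{k}$ is linear with $g^\mathrm{QSym}(M_\emptyset)=0$, $g^\mathrm{QSym}(M_\alpha)=g(\alpha)$ for $\alpha\ne\emptyset$. A character is an algebra map to $\mathbbm{k}$; an infinitesimal character is a linear $\xi$ with $\xi(ab)=\varepsilon(a)\xi(b)+\xi(a)\varepsilon(b)$. -}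

module Defs where

open import Level using (Level; _⊔_) renaming (suc to lsuc)
open import Algebra.Bundles using (CommutativeRing)
open import Data.Nat as ℕ using (ℕ; zero; suc)
open import Data.List as List using (List; []; _∷_; _++_; map; concatMap)
open import Data.List.Properties using (≡-dec)
open import Data.Nat.ListAction using (sum)
open import Data.Product using (_×_; _,_; ∃)
open import Data.Product.Properties using () renaming (≡-dec to ×-≡-dec)
open import Relation.Nullary using (¬_; yes; no; Dec)
open import Relation.Binary.PropositionalEquality using (_≡_)

record Field (c ℓ : Level) : Set (lsuc (c ⊔ ℓ)) where
  field
    commutativeRing : CommutativeRing c ℓ
  open CommutativeRing commutativeRing public
  field
    1#≉0#   : ¬ (1# ≈ 0#)
    inverse : ∀ x → ¬ (x ≈ 0#) → ∃ λ y → (x * y) ≈ 1#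

-- ENCODING: the natural
-- number k in the list stands for the positive part (k + 1); this gives
-- a bijection between List ℕ and the set of all compositions
-- (the empty list is the empty composition).

Comp : Set
Comp = List ℕ

single : ℕ → Comp
single n = n ∷ []

size : Comp → ℕ
size α = sum (map suc α)

-- The part (a+1)+(b+1) is encoded as suc (a + b).
addPart : ℕ → ℕ → ℕ
addPart a b = suc (a ℕ.+ b)

_≟C_ : (α β : Comp) → Dec (α ≡ β)
_≟C_ = ≡-dec ℕ._≟_

_≟C2_ : (p q : Comp × Comp) → Dec (p ≡ q)
_≟C2_ = ×-≡-dec _≟C_ _≟C_

shuffles : Comp → Comp → List Comp
shuffles []      β       = β ∷ []
shuffles (a ∷ α) []      = (a ∷ α) ∷ []
shuffles (a ∷ α) (b ∷ β) =
  map (a ∷_) (shuffles α (b ∷ β)) ++ map (b ∷_) (shuffles (a ∷ α) β)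

-- Multiset of quasi-shuffles (stuffles) of α and β; this gives the
-- product of the monomial quasisymmetric functions:
--   M_α M_β = Σ_{γ ∈ quasiShuffles α β} M_γ.
quasiShuffles : Comp → Comp → List Comp
quasiShuffles []      β       = β ∷ []
quasiShuffles (a ∷ α) []      = (a ∷ α) ∷ []
quasiShuffles (a ∷ α) (b ∷ β) =
     map (a ∷_) (quasiShuffles α (b ∷ β))
  ++ map (b ∷_) (quasiShuffles (a ∷ α) β)
  ++ map (addPart a b ∷_) (quasiShuffles α β)

deconcatenations : Comp → List (Comp × Comp)
deconcatenations []      = ([] , []) ∷ []
deconcatenations (a ∷ γ) =
  ([] , a ∷ γ) ∷ map (λ { (α , β) → (a ∷ α , β) }) (deconcatenations γ)

-- These are in bijection with the compositions β ≥ α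
-- (β_i = |α⁽ⁱ⁾|); for α = ∅ there is exactly one (empty) splitting.
splittings : Comp → List (List Comp)
splittings []          = [] ∷ []
splittings (a ∷ [])    = ((a ∷ []) ∷ []) ∷ []
splittings (a ∷ b ∷ α) =
     map (λ bs → (a ∷ []) ∷ bs) (splittings (b ∷ α))
  ++ map glue (splittings (b ∷ α))
  where
  glue : List Comp → List Comp
  glue []         = []
  glue (bl ∷ bls) = (a ∷ bl) ∷ bls

blockSum : Comp → ℕ
blockSum bl = size bl ℕ.∸ 1

coarsening : List Comp → Comp
coarsening = map blockSum

-- Linear algebra over a field: free vector spaces with a basis indexed
-- by a type with decidable equality, elements being finite formal
-- linear combinations, equality being equality of all coefficients.

module LinearAlgebra {c ℓ : Level} (F : Field c ℓ) where
  open Field F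

  K : Set c
  K = Carrier

  -- f(α, β) = f(α⁽¹⁾) ⋯ f(α⁽ᵏ⁾) for the splitting α⁽¹⁾ ⋯ α⁽ᵏ⁾
  blockProd : (Comp → K) → List Comp → K
  blockProd f = List.foldr (λ bl r → f bl * r) 1#

  Nonsingular : (Comp → K) → Set ℓ
  Nonsingular f = ∀ n → ¬ (f (single n) ≈ 0#)

  Lin : ∀ {b} → Set b → Set (c ⊔ b)
  Lin B = List (K × B)

  module _ {b} {B : Set b} (_≟_ : (x y : B) → Dec (x ≡ y)) where

    coeff : Lin B → B → K
    coeff []             y = 0#
    coeff ((k , x) ∷ v)  y with x ≟ y
    ... | yes _ = k + coeff v y
    ... | no  _ = coeff v y

    _≈L_ : Lin B → Lin B → Set (ℓ ⊔ b)
    v ≈L w = ∀ y → coeff v y ≈ coeff w y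

  basisVec : ∀ {b} {B : Set b} → B → Lin B
  basisVec x = (1# , x) ∷ []

  zeroL : ∀ {b} {B : Set b} → Lin B
  zeroL = []

  _+L_ : ∀ {b} {B : Set b} → Lin B → Lin B → Lin B
  _+L_ = _++_

  scale : ∀ {b} {B : Set b} → K → Lin B → Lin B
  scale k = map (λ { (k' , x) → (k * k' , x) })

  sumL : ∀ {b} {B : Set b} → List (Lin B) → Lin B
  sumL = List.foldr _+L_ zeroL

  extend : ∀ {b b'} {B : Set b} {B' : Set b'} → (B → Lin B') → Lin B → Lin B'
  extend φ v = sumL (map (λ { (k , x) → scale k (φ x) }) v)

  extendK : ∀ {b} {B : Set b} → (B → K) → Lin B → K
  extendK φ v = List.foldr (λ { (k , x) r → k * φ x + r }) 0# v

  extend₂ : ∀ {b b'} {B : Set b} {B' : Set b'} → (B → B → Lin B') → Lin B → Lin B → Lin B'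
  extend₂ μ v w =
    sumL (map (λ { (k , x) → sumL (map (λ { (k' , y) → scale (k * k') (μ x y) }) w) }) v)

  _⊗L_ : ∀ {b b'} {B : Set b} {B' : Set b'} → Lin B → Lin B' → Lin (B × B')
  v ⊗L w = List.concatMap (λ { (k , x) → map (λ { (k' , y) → (k * k' , (x , y)) }) w }) v

  -- QSym, presented in its monomial basis {M_α}: product of M's is the
  -- quasi-shuffle product, coproduct is deconcatenation,
  -- counit ε(M_∅) = 1, ε(M_α) = 0 otherwise.

  QSym : Set c
  QSym = Lin Comp

  QSym⊗QSym : Set c
  QSym⊗QSym = Lin (Comp × Comp)

  _≈Q_ : QSym → QSym → Set ℓ
  _≈Q_ = _≈L_ _≟C_

  _≈Q⊗Q_ : QSym⊗QSym → QSym⊗QSym → Set ℓ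
  _≈Q⊗Q_ = _≈L_ _≟C2_

  M : Comp → QSym
  M = basisVec

  _·Q_ : QSym → QSym → QSym
  _·Q_ = extend₂ (λ α β → List.map (λ γ → (1# , γ)) (quasiShuffles α β))

  ΔQ : QSym → QSym⊗QSym
  ΔQ = extend (λ γ → List.map (λ p → (1# , p)) (deconcatenations γ))

  εM : Comp → K
  εM []      = 1#
  εM (_ ∷ _) = 0#

  εQ : QSym → K
  εQ = extendK εM

  -- the element Σ_{β ≥ α} f(α, β) M_β
  expandM : (Comp → K) → Comp → QSym
  expandM f α = sumL (map (λ bls → scale (blockProd f bls) (M (coarsening bls))) (splittings α))

  expandX : (Comp → QSym) → (Comp → K) → Comp → QSym
  expandX X g α = sumL (map (λ bls → scale (blockProd g bls) (X (coarsening bls))) (splittings α))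

  combX : (Comp → QSym) → Lin Comp → QSym
  combX X = extend X

  Graded : (Comp → QSym) → Set ℓ
  Graded X = ∀ α β → ¬ (coeff _≟C_ (X α) β ≈ 0#) → size β ≡ size α

  Spanning : (Comp → QSym) → Set (c ⊔ ℓ)
  Spanning X = ∀ (v : QSym) → ∃ λ (w : Lin Comp) → combX X w ≈Q v

  LinIndependent : (Comp → QSym) → Set (c ⊔ ℓ)
  LinIndependent X = ∀ (w : Lin Comp) → combX X w ≈Q zeroL → w ≈Q zeroL

  IsGradedBasis : (Comp → QSym) → Set (c ⊔ ℓ)
  IsGradedBasis X = Graded X × Spanning X × LinIndependent X

  IsDeconcatenationBasis : (Comp → QSym) → Set (c ⊔ ℓ)
  IsDeconcatenationBasis X =
    IsGradedBasis X ×
    (∀ γ → ΔQ (X γ) ≈Q⊗Q sumL (map (λ { (α , β) → X α ⊗L X β }) (deconcatenations γ)))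

  IsShuffleBasis : (Comp → QSym) → Set (c ⊔ ℓ)
  IsShuffleBasis X =
    IsDeconcatenationBasis X ×
    (∀ α β → (X α ·Q X β) ≈Q sumL (map X (shuffles α β)))

  Sh : Set c
  Sh = Lin Comp

  x : Comp → Sh
  x = basisVec

  _·Sh_ : Sh → Sh → Sh
  _·Sh_ = extend₂ (λ α β → List.map (λ γ → (1# , γ)) (shuffles α β))

  oneSh : Sh
  oneSh = x []

  fSh : (Comp → K) → Sh → K
  fSh f = extendK (λ { [] → 1# ; (a ∷ α) → f (a ∷ α) })

  gQSym : (Comp → K) → QSym → K
  gQSym g = extendK (λ { [] → 0# ; (a ∷ α) → g (a ∷ α) })

  IsCharacterSh : (Sh → K) → Set (c ⊔ ℓ)
  IsCharacterSh φ =
    (∀ a b → φ (a ·Sh b) ≈ φ a * φ b) × (φ oneSh ≈ 1#)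

  IsInfinitesimalCharacterQSym : (QSym → K) → Set (c ⊔ ℓ)
  IsInfinitesimalCharacterQSym ξ =
    ∀ a b → ξ (a ·Q b) ≈ (εQ a * ξ b + ξ a * εQ b)

{-# OPTIONS --safe #-}
module Submission where

-- The coefficient of M_δ in X_α X_β, and in Σ_{γ ∈ α ⧢ β} X_γ, both obey a recursion on δ:
-- peeling off the first part of δ deconcatenates α = p s and β = q t and weighs the
-- leading blocks (p, q) by a kernel, because deconcatenation is multiplicative for
-- quasi-shuffles and for shuffles alike.  The kernels are f(p) f(q) and Σ_{r ∈ p ⧢ q} f(r)
-- (with f(∅) = 1), so the two families agree iff the kernels agree in positive degree,
-- i.e. iff f^Sh is a character.  The expansion of M_α says that x_α ↦ X_α and
-- M_α ↦ Σ g(α, β) x_β are mutually inverse linear maps Sh ⇄ QSym, so one is an algebra map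
-- iff the other is; for the second map the same recursion, with the roles of shuffles and
-- quasi-shuffles exchanged, has kernels Σ g(r) over the quasi-shuffles r of p and q and
-- ε(p) g(q) + g(p) ε(q) (with g(∅) = 0), which is the infinitesimal character condition.

open import Defs
open import Level using (Level; _⊔_)
open import Function.Bundles using (_⇔_; mk⇔; Equivalence)
open import Function.Properties.Equivalence using () renaming (sym to ⇔-sym; trans to ⇔-trans)
open import Data.Bool using (Bool; true; false)
open import Data.Empty using (⊥-elim)
open import Data.Nat as ℕ using (ℕ; zero; suc)
import Data.Nat.Properties as ℕ
open import Data.List using (List; []; _∷_; _++_; map; concatMap; filter; deduplicate)
open import Data.List.Properties using (++-identityʳ)
open import Data.List.Relation.Unary.All as All using (All; []; _∷_)
open import Data.List.Relation.Unary.All.Properties using (++⁺; ++⁻ˡ; ++⁻ʳ; map⁺; concat⁺)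
open import Data.Product using (_×_; _,_; proj₁; proj₂)
open import Relation.Nullary using (¬_; ¬?; yes; no)
open import Relation.Binary.PropositionalEquality as ≡ using (_≡_)
open import Data.Maybe using (nothing)
open import Tactic.RingSolver using (solve-∀)
open import Tactic.RingSolver.Core.AlmostCommutativeRing using (AlmostCommutativeRing; fromCommutativeRing)
open import Algebra.Properties.CommutativeSemigroup ℕ.+-commutativeSemigroup
  using () renaming (interchange to +-interchange; x∙yz≈y∙xz to +-exchange)

-- Shuffles and quasi-shuffles differ only in the "diagonal" terms, which merge the two
-- leading parts into one.
record IsShuffleLike (S : Comp → Comp → List Comp) : Set where
  field
    diagonal      : ℕ → ℕ → List ℕ
    nilˡ          : ∀ β → S [] β ≡ β ∷ []
    nilʳ          : ∀ α → S α [] ≡ α ∷ []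
    cons          : ∀ a α b β → S (a ∷ α) (b ∷ β) ≡
                      map (a ∷_) (S α (b ∷ β)) ++ map (b ∷_) (S (a ∷ α) β)
                        ++ concatMap (λ c → map (c ∷_) (S α β)) (diagonal a b)
    diagonal-size : ∀ a b → All (λ c → suc c ≡ suc a ℕ.+ suc b) (diagonal a b)

  size-∈ : ∀ α β → All (λ γ → size γ ≡ size α ℕ.+ size β) (S α β)
  size-∈ [] β = ≡.subst (All _) (≡.sym (nilˡ β)) (≡.refl ∷ [])
  size-∈ (a ∷ α) [] = ≡.subst (All _) (≡.sym (nilʳ (a ∷ α))) (≡.sym (ℕ.+-identityʳ (size (a ∷ α))) ∷ [])
  size-∈ (a ∷ α) (b ∷ β) = ≡.subst (All _) (≡.sym (cons a α b β))
    (++⁺ (map⁺ (All.map (λ {γ} → left {γ}) (size-∈ α (b ∷ β))))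
      (++⁺ (map⁺ (All.map (λ {γ} → right {γ}) (size-∈ (a ∷ α) β)))
           (concat⁺ (map⁺ {f = λ c → map (c ∷_) (S α β)} (All.map (λ {c} → diag {c}) (diagonal-size a b))))))
    where
    left : ∀ {γ} → size γ ≡ size α ℕ.+ size (b ∷ β) → size (a ∷ γ) ≡ size (a ∷ α) ℕ.+ size (b ∷ β)
    left e = ≡.trans (≡.cong (suc a ℕ.+_) e) (≡.sym (ℕ.+-assoc (suc a) (size α) (size (b ∷ β))))
    right : ∀ {γ} → size γ ≡ size (a ∷ α) ℕ.+ size β → size (b ∷ γ) ≡ size (a ∷ α) ℕ.+ size (b ∷ β)
    right e = ≡.trans (≡.cong (suc b ℕ.+_) e) (+-exchange (suc b) (size (a ∷ α)) (size β))
    diag : ∀ {c} → suc c ≡ suc a ℕ.+ suc b → All (λ γ → size γ ≡ size (a ∷ α) ℕ.+ size (b ∷ β)) (map (c ∷_) (S α β))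
    diag e = map⁺ (All.map (λ e′ → ≡.trans (≡.cong₂ ℕ._+_ e e′) (+-interchange (suc a) (suc b) (size α) (size β))) (size-∈ α β))

shuffles-isShuffleLike : IsShuffleLike shuffles
shuffles-isShuffleLike = record
  { diagonal      = λ _ _ → []
  ; nilˡ          = λ _ → ≡.refl
  ; nilʳ          = λ { [] → ≡.refl ; (_ ∷ _) → ≡.refl }
  ; cons          = λ a α b β → ≡.cong (map (a ∷_) (shuffles α (b ∷ β)) ++_) (≡.sym (++-identityʳ _))
  ; diagonal-size = λ _ _ → []
  }

quasiShuffles-isShuffleLike : IsShuffleLike quasiShuffles
quasiShuffles-isShuffleLike = record
  { diagonal      = λ a b → addPart a b ∷ []
  ; nilˡ          = λ _ → ≡.refl
  ; nilʳ          = λ { [] → ≡.refl ; (_ ∷ _) → ≡.refl }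
  ; cons          = λ a α b β → ≡.cong (λ l → map (a ∷_) (quasiShuffles α (b ∷ β)) ++ map (b ∷_) (quasiShuffles (a ∷ α) β) ++ l)
                                       (≡.sym (++-identityʳ _))
  ; diagonal-size = λ a b → ≡.cong suc (≡.sym (ℕ.+-suc a b)) ∷ []
  }

private variable
  ℓᵃ ℓᵇ ℓᵇ′ : Level
  A : Set ℓᵃ
  B : Set ℓᵇ
  B′ : Set ℓᵇ′

module _ {c ℓ : Level} (F : Field c ℓ) where
  open Field F
  open LinearAlgebra F
  open import Relation.Binary.Reasoning.Setoid setoid
  open import Algebra.Properties.CommutativeSemigroup +-commutativeSemigroup
    using (interchange)

  private
    ring-for-solver : AlmostCommutativeRing c ℓ
    ring-for-solver = fromCommutativeRing commutativeRing (λ _ → nothing)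
    module R = AlmostCommutativeRing ring-for-solver

  ∑ : List A → (A → K) → K
  ∑ []       h = 0#
  ∑ (x ∷ xs) h = h x + ∑ xs h

  ∑-cong : (xs : List A) {h h′ : A → K} → (∀ x → h x ≈ h′ x) → ∑ xs h ≈ ∑ xs h′
  ∑-cong []       e = refl
  ∑-cong (x ∷ xs) e = +-cong (e x) (∑-cong xs e)

  ∑-++ : (xs ys : List A) (h : A → K) → ∑ (xs ++ ys) h ≈ ∑ xs h + ∑ ys h
  ∑-++ []       ys h = sym (+-identityˡ _)
  ∑-++ (x ∷ xs) ys h = trans (+-cong refl (∑-++ xs ys h)) (sym (+-assoc _ _ _))

  ∑-map : (g : A → B) (xs : List A) (h : B → K) →
          ∑ (map g xs) h ≡ ∑ xs (λ x → h (g x))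
  ∑-map g []       h = ≡.refl
  ∑-map g (x ∷ xs) h = ≡.cong (h (g x) +_) (∑-map g xs h)

  ∑-concatMap : (g : A → List B) (xs : List A) (h : B → K) →
                ∑ (concatMap g xs) h ≈ ∑ xs (λ x → ∑ (g x) h)
  ∑-concatMap g []       h = refl
  ∑-concatMap g (x ∷ xs) h = trans (∑-++ (g x) _ h) (+-cong refl (∑-concatMap g xs h))

  ∑-zero : (xs : List A) {h : A → K} → (∀ x → h x ≈ 0#) → ∑ xs h ≈ 0#
  ∑-zero []       e = refl
  ∑-zero (x ∷ xs) e = trans (+-cong (e x) (∑-zero xs e)) (+-identityˡ _)

  ∑-+ : (xs : List A) (h h′ : A → K) → ∑ xs (λ x → h x + h′ x) ≈ ∑ xs h + ∑ xs h′
  ∑-+ []       h h′ = sym (+-identityˡ _)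
  ∑-+ (x ∷ xs) h h′ = trans (+-cong refl (∑-+ xs h h′)) (interchange _ _ _ _)

  *-distribˡ-∑ : (k : K) (xs : List A) (h : A → K) → k * ∑ xs h ≈ ∑ xs (λ x → k * h x)
  *-distribˡ-∑ k []       h = zeroʳ k
  *-distribˡ-∑ k (x ∷ xs) h = trans (distribˡ k _ _) (+-cong refl (*-distribˡ-∑ k xs h))

  *-distribʳ-∑ : (k : K) (xs : List A) (h : A → K) → ∑ xs h * k ≈ ∑ xs (λ x → h x * k)
  *-distribʳ-∑ k []       h = zeroˡ k
  *-distribʳ-∑ k (x ∷ xs) h = trans (distribʳ k _ _) (+-cong refl (*-distribʳ-∑ k xs h))

  ∑-*-∑ : (xs : List A) (ys : List B) (h : A → K) (h′ : B → K) →
          ∑ xs h * ∑ ys h′ ≈ ∑ xs (λ x → ∑ ys (λ y → h x * h′ y))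
  ∑-*-∑ xs ys h h′ = trans (*-distribʳ-∑ _ xs h) (∑-cong xs (λ x → *-distribˡ-∑ (h x) ys h′))

  ∑-swap : (xs : List A) (ys : List B) (h : A → B → K) →
           ∑ xs (λ x → ∑ ys (h x)) ≈ ∑ ys (λ y → ∑ xs (λ x → h x y))
  ∑-swap []       ys h = sym (∑-zero ys (λ _ → refl))
  ∑-swap (x ∷ xs) ys h = trans (+-cong refl (∑-swap xs ys h)) (sym (∑-+ ys (h x) _))

  ⟪_∣_⟫ : Lin B → (B → K) → K
  ⟪ v ∣ φ ⟫ = extendK φ v

  pair-cong : (v : Lin B) {φ φ′ : B → K} → (∀ x → φ x ≈ φ′ x) → ⟪ v ∣ φ ⟫ ≈ ⟪ v ∣ φ′ ⟫
  pair-cong []      e = refl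
  pair-cong (p ∷ v) e = +-cong (*-cong refl (e (proj₂ p))) (pair-cong v e)

  pair-++ : (v w : Lin B) (φ : B → K) → ⟪ v ++ w ∣ φ ⟫ ≈ ⟪ v ∣ φ ⟫ + ⟪ w ∣ φ ⟫
  pair-++ []      w φ = sym (+-identityˡ _)
  pair-++ (p ∷ v) w φ = trans (+-cong refl (pair-++ v w φ)) (sym (+-assoc _ _ _))

  pair-scale : (k : K) (v : Lin B) (φ : B → K) → ⟪ scale k v ∣ φ ⟫ ≈ k * ⟪ v ∣ φ ⟫
  pair-scale k []      φ = sym (zeroʳ k)
  pair-scale k (p ∷ v) φ = trans (+-cong (*-assoc _ _ _) (pair-scale k v φ)) (sym (distribˡ k _ _))

  pair-sumL : (vs : List (Lin B)) (φ : B → K) → ⟪ sumL vs ∣ φ ⟫ ≈ ∑ vs (λ v → ⟪ v ∣ φ ⟫)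
  pair-sumL []       φ = refl
  pair-sumL (v ∷ vs) φ = trans (pair-++ v (sumL vs) φ) (+-cong refl (pair-sumL vs φ))

  pair-basisVec : (x : B) (φ : B → K) → ⟪ basisVec x ∣ φ ⟫ ≈ φ x
  pair-basisVec x φ = trans (+-identityʳ _) (*-identityˡ _)

  pair-unitCoefficients : (xs : List B) (φ : B → K) → ⟪ map (λ x → (1# , x)) xs ∣ φ ⟫ ≈ ∑ xs φ
  pair-unitCoefficients []       φ = refl
  pair-unitCoefficients (x ∷ xs) φ = +-cong (*-identityˡ _) (pair-unitCoefficients xs φ)

  pair-zero : (v : Lin B) → ⟪ v ∣ (λ _ → 0#) ⟫ ≈ 0#
  pair-zero []      = refl
  pair-zero (p ∷ v) = trans (+-cong (zeroʳ _) (pair-zero v)) (+-identityˡ _)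

  pair-+ : (v : Lin B) (φ φ′ : B → K) → ⟪ v ∣ (λ x → φ x + φ′ x) ⟫ ≈ ⟪ v ∣ φ ⟫ + ⟪ v ∣ φ′ ⟫
  pair-+ []      φ φ′ = sym (+-identityˡ _)
  pair-+ (p ∷ v) φ φ′ = trans (+-cong (distribˡ _ _ _) (pair-+ v φ φ′)) (interchange _ _ _ _)

  pair-*ˡ : (k : K) (v : Lin B) (φ : B → K) → ⟪ v ∣ (λ x → k * φ x) ⟫ ≈ k * ⟪ v ∣ φ ⟫
  pair-*ˡ k []      φ = sym (zeroʳ k)
  pair-*ˡ k (p ∷ v) φ = trans (+-cong (x∙yz≈y∙xz _ _ _) (pair-*ˡ k v φ)) (sym (distribˡ k _ _))
    where open import Algebra.Properties.CommutativeSemigroup *-commutativeSemigroup using (x∙yz≈y∙xz)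

  pair-*ʳ : (k : K) (v : Lin B) (φ : B → K) → ⟪ v ∣ (λ x → φ x * k) ⟫ ≈ ⟪ v ∣ φ ⟫ * k
  pair-*ʳ k v φ = trans (pair-cong v (λ x → *-comm _ _)) (trans (pair-*ˡ k v φ) (*-comm _ _))

  pair-∑ : (v : Lin B) (xs : List A) (h : A → B → K) →
           ⟪ v ∣ (λ y → ∑ xs (λ x → h x y)) ⟫ ≈ ∑ xs (λ x → ⟪ v ∣ h x ⟫)
  pair-∑ v []       h = pair-zero v
  pair-∑ v (x ∷ xs) h = trans (pair-+ v (h x) _) (+-cong refl (pair-∑ v xs h))

  pair-swap : (v : Lin B) (w : Lin B′) (h : B → B′ → K) →
              ⟪ v ∣ (λ x → ⟪ w ∣ h x ⟫) ⟫ ≈ ⟪ w ∣ (λ y → ⟪ v ∣ (λ x → h x y) ⟫) ⟫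
  pair-swap []      w h = sym (pair-zero w)
  pair-swap (p ∷ v) w h = begin
      proj₁ p * ⟪ w ∣ h (proj₂ p) ⟫ + ⟪ v ∣ (λ x → ⟪ w ∣ h x ⟫) ⟫
    ≈⟨ +-cong (sym (pair-*ˡ (proj₁ p) w _)) (pair-swap v w h) ⟩
      ⟪ w ∣ (λ y → proj₁ p * h (proj₂ p) y) ⟫ + ⟪ w ∣ (λ y → ⟪ v ∣ (λ x → h x y) ⟫) ⟫
    ≈⟨ sym (pair-+ w _ _) ⟩
      ⟪ w ∣ (λ y → ⟪ p ∷ v ∣ (λ x → h x y) ⟫) ⟫ ∎

  pair-extend : (ψ : B → Lin B′) (v : Lin B) (φ : B′ → K) →
                ⟪ extend ψ v ∣ φ ⟫ ≈ ⟪ v ∣ (λ x → ⟪ ψ x ∣ φ ⟫) ⟫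
  pair-extend ψ []      φ = refl
  pair-extend ψ (p ∷ v) φ = trans (pair-++ (scale (proj₁ p) (ψ (proj₂ p))) _ φ)
                                  (+-cong (pair-scale (proj₁ p) (ψ (proj₂ p)) φ) (pair-extend ψ v φ))

  ⟪_⊗_∣_⟫ : Lin B → Lin B′ → (B → B′ → K) → K
  ⟪ v ⊗ w ∣ Φ ⟫ = ⟪ v ∣ (λ x → ⟪ w ∣ Φ x ⟫) ⟫

  pair⊗-cong : (v : Lin B) (w : Lin B′) {Φ Φ′ : B → B′ → K} → (∀ x y → Φ x y ≈ Φ′ x y) → ⟪ v ⊗ w ∣ Φ ⟫ ≈ ⟪ v ⊗ w ∣ Φ′ ⟫
  pair⊗-cong v w e = pair-cong v (λ x → pair-cong w (e x))

  pair⊗-+ : (v : Lin B) (w : Lin B′) (Φ Φ′ : B → B′ → K) →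
            ⟪ v ⊗ w ∣ (λ x y → Φ x y + Φ′ x y) ⟫ ≈ ⟪ v ⊗ w ∣ Φ ⟫ + ⟪ v ⊗ w ∣ Φ′ ⟫
  pair⊗-+ v w Φ Φ′ = trans (pair-cong v (λ x → pair-+ w (Φ x) (Φ′ x))) (pair-+ v _ _)

  pair⊗-*ˡ : (k : K) (v : Lin B) (w : Lin B′) (Φ : B → B′ → K) → ⟪ v ⊗ w ∣ (λ x y → k * Φ x y) ⟫ ≈ k * ⟪ v ⊗ w ∣ Φ ⟫
  pair⊗-*ˡ k v w Φ = trans (pair-cong v (λ x → pair-*ˡ k w (Φ x))) (pair-*ˡ k v _)

  pair⊗-∑ : (v : Lin B) (w : Lin B′) (xs : List A) (Φ : A → B → B′ → K) →
            ⟪ v ⊗ w ∣ (λ x y → ∑ xs (λ z → Φ z x y)) ⟫ ≈ ∑ xs (λ z → ⟪ v ⊗ w ∣ Φ z ⟫)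
  pair⊗-∑ v w xs Φ = trans (pair-cong v (λ x → pair-∑ w xs (λ z → Φ z x))) (pair-∑ v xs _)

  pair⊗-* : (v : Lin B) (w : Lin B′) (φ : B → K) (ψ : B′ → K) → ⟪ v ⊗ w ∣ (λ x y → φ x * ψ y) ⟫ ≈ ⟪ v ∣ φ ⟫ * ⟪ w ∣ ψ ⟫
  pair⊗-* v w φ ψ = trans (pair-cong v (λ x → pair-*ˡ (φ x) w ψ)) (pair-*ʳ _ v φ)

  pair⊗-basisVec : (x : B) (y : B′) (Φ : B → B′ → K) → ⟪ basisVec x ⊗ basisVec y ∣ Φ ⟫ ≈ Φ x y
  pair⊗-basisVec x y Φ = trans (pair-basisVec x (λ x′ → ⟪ basisVec y ∣ Φ x′ ⟫)) (pair-basisVec y (Φ x))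

  pair-extend₂ : (μ : B → B → Lin B′) (v w : Lin B) (φ : B′ → K) →
                 ⟪ extend₂ μ v w ∣ φ ⟫ ≈ ⟪ v ⊗ w ∣ (λ x y → ⟪ μ x y ∣ φ ⟫) ⟫
  pair-extend₂ μ []            w φ = refl
  pair-extend₂ {B = B} μ ((k , x) ∷ v) w φ =
    trans (pair-++ (row w) _ φ) (+-cong (pair-row w) (pair-extend₂ μ v w φ))
    where
    row : Lin B → Lin _
    row w′ = sumL (map (λ { (k′ , y) → scale (k * k′) (μ x y) }) w′)
    pair-row : ∀ w′ → ⟪ row w′ ∣ φ ⟫ ≈ k * ⟪ w′ ∣ (λ y → ⟪ μ x y ∣ φ ⟫) ⟫
    pair-row []             = sym (zeroʳ _)
    pair-row ((k′ , y) ∷ w′) = begin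
        ⟪ scale (k * k′) (μ x y) ++ row w′ ∣ φ ⟫
      ≈⟨ pair-++ (scale (k * k′) (μ x y)) _ φ ⟩
        ⟪ scale (k * k′) (μ x y) ∣ φ ⟫ + ⟪ row w′ ∣ φ ⟫
      ≈⟨ +-cong (trans (pair-scale (k * k′) (μ x y) φ) (*-assoc _ _ _)) (pair-row w′) ⟩
        k * (k′ * ⟪ μ x y ∣ φ ⟫) + k * ⟪ w′ ∣ (λ y → ⟪ μ x y ∣ φ ⟫) ⟫
      ≈⟨ sym (distribˡ _ _ _) ⟩
        k * ⟪ (k′ , y) ∷ w′ ∣ (λ y → ⟪ μ x y ∣ φ ⟫) ⟫ ∎

  ⟦_⟧ : Bool → K
  ⟦ true  ⟧ = 1#
  ⟦ false ⟧ = 0#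

  [_≐_] : ℕ → ℕ → K
  [ m ≐ n ] = ⟦ m ℕ.≡ᵇ n ⟧

  ≐-refl : ∀ n → [ n ≐ n ] ≈ 1#
  ≐-refl zero    = refl
  ≐-refl (suc n) = ≐-refl n

  ≐-≢ : ∀ {m n} → ¬ m ≡ n → [ m ≐ n ] ≈ 0#
  ≐-≢ {zero}  {zero}  m≢n = ⊥-elim (m≢n ≡.refl)
  ≐-≢ {zero}  {suc n} m≢n = refl
  ≐-≢ {suc m} {zero}  m≢n = refl
  ≐-≢ {suc m} {suc n} m≢n = ≐-≢ (λ e → m≢n (≡.cong suc e))

  ∑-≐-const : ∀ (size′ : A → ℕ) {m} n (xs : List A) (h : A → K) → All (λ x → size′ x ≡ m) xs →
              ∑ xs (λ x → [ size′ x ≐ n ] * h x) ≈ [ m ≐ n ] * ∑ xs h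
  ∑-≐-const size′ n []       h []       = sym (zeroʳ _)
  ∑-≐-const size′ n (x ∷ xs) h (e ∷ es) =
    trans (+-cong (*-cong (reflexive (≡.cong (λ k → [ k ≐ n ]) e)) refl) (∑-≐-const size′ n xs h es)) (sym (distribˡ _ _ _))

  [_≐ᶜ_] : Comp → Comp → K
  [ []    ≐ᶜ []    ] = 1#
  [ []    ≐ᶜ _ ∷ _ ] = 0#
  [ _ ∷ _ ≐ᶜ []    ] = 0#
  [ a ∷ α ≐ᶜ b ∷ β ] = [ a ≐ b ] * [ α ≐ᶜ β ]

  ≐ᶜ-refl : ∀ α → [ α ≐ᶜ α ] ≈ 1#
  ≐ᶜ-refl []      = refl
  ≐ᶜ-refl (a ∷ α) = trans (*-cong (≐-refl a) (≐ᶜ-refl α)) (*-identityˡ _)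

  ≐ᶜ-≢ : ∀ {α β} → ¬ α ≡ β → [ α ≐ᶜ β ] ≈ 0#
  ≐ᶜ-≢ {[]}    {[]}    α≢β = ⊥-elim (α≢β ≡.refl)
  ≐ᶜ-≢ {[]}    {_ ∷ _} α≢β = refl
  ≐ᶜ-≢ {_ ∷ _} {[]}    α≢β = refl
  ≐ᶜ-≢ {a ∷ α} {b ∷ β} α≢β with a ℕ.≟ b
  ... | no a≢b     = trans (*-cong (≐-≢ a≢b) refl) (zeroˡ _)
  ... | yes ≡.refl = trans (*-cong refl (≐ᶜ-≢ (λ e → α≢β (≡.cong (a ∷_) e)))) (zeroʳ _)

  ≐ᶜ-[] : ∀ γ → [ γ ≐ᶜ [] ] ≈ εM γ
  ≐ᶜ-[] []      = refl
  ≐ᶜ-[] (_ ∷ _) = refl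

  coeff-∷ : ∀ k α (v : Lin Comp) β → coeff _≟C_ ((k , α) ∷ v) β ≈ k * [ α ≐ᶜ β ] + coeff _≟C_ v β
  coeff-∷ k α v β with α ≟C β
  ... | yes ≡.refl = +-cong (sym (trans (*-cong refl (≐ᶜ-refl α)) (*-identityʳ k))) refl
  ... | no α≢β     = sym (trans (+-cong (trans (*-cong refl (≐ᶜ-≢ α≢β)) (zeroʳ k)) refl) (+-identityˡ _))

  coeff≈pair : (v : Lin Comp) (β : Comp) → coeff _≟C_ v β ≈ ⟪ v ∣ (λ α → [ α ≐ᶜ β ]) ⟫
  coeff≈pair []            β = refl
  coeff≈pair ((k , α) ∷ v) β = trans (coeff-∷ k α v β) (+-cong refl (coeff≈pair v β))

  -- holds when S is duplicate-free and contains α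
  Sifts : List Comp → Comp → Set (c ⊔ ℓ)
  Sifts S α = ∀ (h : Comp → K) → ∑ S (λ β → [ α ≐ᶜ β ] * h β) ≈ h α

  private
    without : Comp → List Comp → List Comp
    without α = filter (λ β → ¬? (α ≟C β))

    ∑-without-self : ∀ α βs (h : Comp → K) → ∑ (without α βs) (λ β → [ α ≐ᶜ β ] * h β) ≈ 0#
    ∑-without-self α []       h = refl
    ∑-without-self α (β ∷ βs) h with α ≟C β
    ... | yes _  = ∑-without-self α βs h
    ... | no α≢β = trans (+-cong (trans (*-cong (≐ᶜ-≢ α≢β) refl) (zeroˡ _)) (∑-without-self α βs h)) (+-identityˡ _)

    ∑-without-other : ∀ α α₀ βs (h : Comp → K) → ¬ α ≡ α₀ →
                      ∑ (without α₀ βs) (λ β → [ α ≐ᶜ β ] * h β) ≈ ∑ βs (λ β → [ α ≐ᶜ β ] * h β)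
    ∑-without-other α α₀ []       h α≢α₀ = refl
    ∑-without-other α α₀ (β ∷ βs) h α≢α₀ with α₀ ≟C β
    ... | yes ≡.refl = trans (∑-without-other α α₀ βs h α≢α₀)
                             (sym (trans (+-cong (trans (*-cong (≐ᶜ-≢ α≢α₀) refl) (zeroˡ _)) refl) (+-identityˡ _)))
    ... | no _       = +-cong refl (∑-without-other α α₀ βs h α≢α₀)

  deduplicate-sifts : ∀ αs → All (Sifts (deduplicate _≟C_ αs)) αs
  deduplicate-sifts []        = []
  deduplicate-sifts (α₀ ∷ αs) = head ∷ All.map tail (deduplicate-sifts αs)
    where
    head : Sifts (deduplicate _≟C_ (α₀ ∷ αs)) α₀
    head h = trans (+-cong (trans (*-cong (≐ᶜ-refl α₀) refl) (*-identityˡ _)) (∑-without-self α₀ (deduplicate _≟C_ αs) h)) (+-identityʳ _)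
    tail : ∀ {α} → Sifts (deduplicate _≟C_ αs) α → Sifts (deduplicate _≟C_ (α₀ ∷ αs)) α
    tail {α} sifts h with α ≟C α₀
    ... | yes ≡.refl = head h
    ... | no α≢α₀    = trans (+-cong (trans (*-cong (≐ᶜ-≢ α≢α₀) refl) (zeroˡ _)) (∑-without-other α α₀ (deduplicate _≟C_ αs) h α≢α₀))
                             (trans (+-identityˡ _) (sifts h))

  pair≈∑coeff : ∀ S (v : Lin Comp) (φ : Comp → K) → All (Sifts S) (map proj₂ v) →
                ⟪ v ∣ φ ⟫ ≈ ∑ S (λ β → coeff _≟C_ v β * φ β)
  pair≈∑coeff S []            φ []               = sym (∑-zero S (λ β → zeroˡ _))
  pair≈∑coeff S ((k , α) ∷ v) φ (sifts ∷ siftsᵥ) = begin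
      k * φ α + ⟪ v ∣ φ ⟫
    ≈⟨ +-cong (*-cong refl (sym (sifts φ))) (pair≈∑coeff S v φ siftsᵥ) ⟩
      k * ∑ S (λ β → [ α ≐ᶜ β ] * φ β) + ∑ S (λ β → coeff _≟C_ v β * φ β)
    ≈⟨ trans (+-cong (*-distribˡ-∑ k S _) refl) (sym (∑-+ S _ _)) ⟩
      ∑ S (λ β → k * ([ α ≐ᶜ β ] * φ β) + coeff _≟C_ v β * φ β)
    ≈⟨ ∑-cong S (λ β → trans (+-cong (sym (*-assoc _ _ _)) refl) (sym (distribʳ _ _ _))) ⟩
      ∑ S (λ β → (k * [ α ≐ᶜ β ] + coeff _≟C_ v β) * φ β)
    ≈⟨ ∑-cong S (λ β → *-cong (sym (coeff-∷ k α v β)) refl) ⟩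
      ∑ S (λ β → coeff _≟C_ ((k , α) ∷ v) β * φ β) ∎

  pair-resp-≈Q : ∀ (v w : Lin Comp) (φ : Comp → K) → v ≈Q w → ⟪ v ∣ φ ⟫ ≈ ⟪ w ∣ φ ⟫
  pair-resp-≈Q v w φ v≈w = begin
      ⟪ v ∣ φ ⟫
    ≈⟨ pair≈∑coeff S v φ (++⁻ˡ (map proj₂ v) sifts) ⟩
      ∑ S (λ β → coeff _≟C_ v β * φ β)
    ≈⟨ ∑-cong S (λ β → *-cong (v≈w β) refl) ⟩
      ∑ S (λ β → coeff _≟C_ w β * φ β)
    ≈⟨ pair≈∑coeff S w φ (++⁻ʳ (map proj₂ v) sifts) ⟨
      ⟪ w ∣ φ ⟫ ∎
    where
    S : List Comp
    S = deduplicate _≟C_ (map proj₂ v ++ map proj₂ w)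
    sifts : All (Sifts S) (map proj₂ v ++ map proj₂ w)
    sifts = deduplicate-sifts (map proj₂ v ++ map proj₂ w)

  ∑Δ : Comp → (Comp → Comp → K) → K
  ∑Δ γ G = ∑ (deconcatenations γ) (λ ps → G (proj₁ ps) (proj₂ ps))

  ∑Δ₂ : Comp → Comp → (Comp → Comp → Comp → Comp → K) → K
  ∑Δ₂ α β G = ∑Δ α (λ p s → ∑Δ β (λ q t → G p s q t))

  ∑Δ⁺ : Comp → (Comp → Comp → K) → K
  ∑Δ⁺ []      G = 0#
  ∑Δ⁺ (a ∷ γ) G = ∑Δ γ (λ p s → G (a ∷ p) s)

  ∑Δ-∷ : ∀ a γ G → ∑Δ (a ∷ γ) G ≈ G [] (a ∷ γ) + ∑Δ γ (λ p s → G (a ∷ p) s)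
  ∑Δ-∷ a γ G = +-cong refl (reflexive (∑-map _ (deconcatenations γ) _))

  ∑Δ≈[]+∑Δ⁺ : ∀ γ G → ∑Δ γ G ≈ G [] γ + ∑Δ⁺ γ G
  ∑Δ≈[]+∑Δ⁺ []      G = refl
  ∑Δ≈[]+∑Δ⁺ (a ∷ γ) G = ∑Δ-∷ a γ G

  ∑Δ-cong : ∀ γ {G G′ : Comp → Comp → K} → (∀ p s → G p s ≈ G′ p s) → ∑Δ γ G ≈ ∑Δ γ G′
  ∑Δ-cong γ e = ∑-cong (deconcatenations γ) (λ ps → e (proj₁ ps) (proj₂ ps))

  ∑Δ₂-cong : ∀ α β {G G′ : Comp → Comp → Comp → Comp → K} →
             (∀ p s q t → G p s q t ≈ G′ p s q t) → ∑Δ₂ α β G ≈ ∑Δ₂ α β G′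
  ∑Δ₂-cong α β e = ∑Δ-cong α (λ p s → ∑Δ-cong β (e p s))

  ∑Δ-+ : ∀ γ (G G′ : Comp → Comp → K) → ∑Δ γ (λ p s → G p s + G′ p s) ≈ ∑Δ γ G + ∑Δ γ G′
  ∑Δ-+ γ G G′ = ∑-+ (deconcatenations γ) _ _

  ∑Δ⁺-cong : ∀ γ {G G′ : Comp → Comp → K} → (∀ a p s → G (a ∷ p) s ≈ G′ (a ∷ p) s) → ∑Δ⁺ γ G ≈ ∑Δ⁺ γ G′
  ∑Δ⁺-cong []      e = refl
  ∑Δ⁺-cong (a ∷ γ) e = ∑Δ-cong γ (λ p s → e a p s)

  ∑Δ⁺-+ : ∀ γ (G G′ : Comp → Comp → K) → ∑Δ⁺ γ (λ p s → G p s + G′ p s) ≈ ∑Δ⁺ γ G + ∑Δ⁺ γ G′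
  ∑Δ⁺-+ []      G G′ = sym (+-identityʳ _)
  ∑Δ⁺-+ (a ∷ γ) G G′ = ∑-+ (deconcatenations γ) _ _

  *-distribˡ-∑Δ⁺ : ∀ γ k (G : Comp → Comp → K) → k * ∑Δ⁺ γ G ≈ ∑Δ⁺ γ (λ p s → k * G p s)
  *-distribˡ-∑Δ⁺ []      k G = zeroʳ k
  *-distribˡ-∑Δ⁺ (a ∷ γ) k G = *-distribˡ-∑ k (deconcatenations γ) _

  ∑Δ₂-split : ∀ α β G → ∑Δ₂ α β G ≈
    (G [] α [] β + ∑Δ⁺ β (G [] α)) + ∑Δ⁺ α (λ p s → G p s [] β + ∑Δ⁺ β (G p s))
  ∑Δ₂-split α β G = trans (∑Δ≈[]+∑Δ⁺ α _) (+-cong (∑Δ≈[]+∑Δ⁺ β _) (∑Δ⁺-cong α (λ a p s → ∑Δ≈[]+∑Δ⁺ β _)))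

  pair-∑Δ⁺ : ∀ (v : Lin Comp) γ (H : Comp → Comp → Comp → K) →
             ⟪ v ∣ (λ x → ∑Δ⁺ γ (λ p s → H p s x)) ⟫ ≈ ∑Δ⁺ γ (λ p s → ⟪ v ∣ H p s ⟫)
  pair-∑Δ⁺ v []      H = pair-zero v
  pair-∑Δ⁺ v (a ∷ γ) H = pair-∑ v (deconcatenations γ) _

  -- only the full deconcatenation γ = γ ∅ survives
  ∑Δ-εM : ∀ γ (H : Comp → K) → ∑Δ γ (λ p s → H p * εM s) ≈ H γ
  ∑Δ-εM []      H = trans (+-identityʳ _) (*-identityʳ _)
  ∑Δ-εM (a ∷ γ) H = trans (trans (∑Δ-∷ a γ _) (+-cong (zeroʳ _) refl)) (trans (+-identityˡ _) (∑Δ-εM γ (λ p → H (a ∷ p))))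

  ∑-splittings-∷ : ∀ a α (H : List Comp → K) →
    ∑ (splittings (a ∷ α)) H ≈ ∑Δ α (λ p s → ∑ (splittings s) (λ bls → H ((a ∷ p) ∷ bls)))
  ∑-splittings-∷ a []      H = sym (+-identityʳ _)
  ∑-splittings-∷ a (b ∷ α) H = begin
      ∑ (map ((a ∷ []) ∷_) (splittings (b ∷ α)) ++ map _ (splittings (b ∷ α))) H
    ≈⟨ ∑-++ (map ((a ∷ []) ∷_) (splittings (b ∷ α))) _ H ⟩
      ∑ (map ((a ∷ []) ∷_) (splittings (b ∷ α))) H + ∑ (map _ (splittings (b ∷ α))) H
    ≈⟨ +-cong (reflexive (∑-map _ (splittings (b ∷ α)) H))
              (trans (reflexive (∑-map _ (splittings (b ∷ α)) H)) (∑-splittings-∷ b α _)) ⟩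
      ∑ (splittings (b ∷ α)) (λ bls → H ((a ∷ []) ∷ bls))
        + ∑Δ α (λ p s → ∑ (splittings s) (λ bls → H ((a ∷ b ∷ p) ∷ bls)))
    ≈⟨ ∑Δ-∷ b α _ ⟨
      ∑Δ (b ∷ α) (λ p s → ∑ (splittings s) (λ bls → H ((a ∷ p) ∷ bls))) ∎

  pair-expandX : ∀ (Y : Comp → QSym) g α (φ : Comp → K) →
    ⟪ expandX Y g α ∣ φ ⟫ ≈ ∑ (splittings α) (λ bls → blockProd g bls * ⟪ Y (coarsening bls) ∣ φ ⟫)
  pair-expandX Y g α φ = begin
      ⟪ sumL (map term (splittings α)) ∣ φ ⟫
    ≈⟨ pair-sumL (map term (splittings α)) φ ⟩
      ∑ (map term (splittings α)) (λ v → ⟪ v ∣ φ ⟫)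
    ≡⟨ ∑-map term (splittings α) _ ⟩
      ∑ (splittings α) (λ bls → ⟪ term bls ∣ φ ⟫)
    ≈⟨ ∑-cong (splittings α) (λ bls → pair-scale (blockProd g bls) (Y (coarsening bls)) φ) ⟩
      ∑ (splittings α) (λ bls → blockProd g bls * ⟪ Y (coarsening bls) ∣ φ ⟫) ∎
    where
    term : List Comp → QSym
    term bls = scale (blockProd g bls) (Y (coarsening bls))

  pair-expandM : ∀ f α (φ : Comp → K) →
    ⟪ expandM f α ∣ φ ⟫ ≈ ∑ (splittings α) (λ bls → blockProd f bls * φ (coarsening bls))
  pair-expandM f α φ = trans (pair-expandX M f α φ)
    (∑-cong (splittings α) (λ bls → *-cong refl (pair-basisVec (coarsening bls) φ)))

  byHead : (ℕ → Comp → K) → Comp → K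
  byHead ψ []      = 0#
  byHead ψ (a ∷ γ) = ψ a γ

  -- The leading part of a coarsening of α is the block sum of a nonempty prefix p of α.
  pair-expandM-byHead : ∀ f α (ψ : ℕ → Comp → K) →
    ⟪ expandM f α ∣ byHead ψ ⟫ ≈ ∑Δ⁺ α (λ p s → f p * ⟪ expandM f s ∣ ψ (blockSum p) ⟫)
  pair-expandM-byHead f []      ψ = trans (+-identityʳ _) (zeroʳ _)
  pair-expandM-byHead f (a ∷ α) ψ = begin
      ⟪ expandM f (a ∷ α) ∣ byHead ψ ⟫
    ≈⟨ trans (pair-expandM f (a ∷ α) (byHead ψ)) (∑-splittings-∷ a α _) ⟩
      ∑Δ α (λ p s → ∑ (splittings s) (λ bls → (f (a ∷ p) * blockProd f bls) * ψ (blockSum (a ∷ p)) (coarsening bls)))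
    ≈⟨ ∑Δ-cong α (λ p s → trans (∑-cong (splittings s) (λ bls → *-assoc _ _ _)) (sym (*-distribˡ-∑ _ (splittings s) _))) ⟩
      ∑Δ α (λ p s → f (a ∷ p) * ∑ (splittings s) (λ bls → blockProd f bls * ψ (blockSum (a ∷ p)) (coarsening bls)))
    ≈⟨ ∑Δ-cong α (λ p s → *-cong refl (pair-expandM f s _)) ⟨
      ∑Δ α (λ p s → f (a ∷ p) * ⟪ expandM f s ∣ ψ (blockSum (a ∷ p)) ⟫) ∎

  pair⊗-byHeadˡ : ∀ f α (w : Lin Comp) (H : ℕ → Comp → Comp → K) →
    ⟪ expandM f α ⊗ w ∣ (λ x y → byHead (λ a x′ → H a x′ y) x) ⟫
      ≈ ∑Δ⁺ α (λ p s → f p * ⟪ expandM f s ⊗ w ∣ H (blockSum p) ⟫)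
  pair⊗-byHeadˡ f α w H =
    trans (pair-cong (expandM f α) pull) (pair-expandM-byHead f α (λ a x′ → ⟪ w ∣ H a x′ ⟫))
    where
    pull : ∀ x → ⟪ w ∣ (λ y → byHead (λ a x′ → H a x′ y) x) ⟫ ≈ byHead (λ a x′ → ⟪ w ∣ H a x′ ⟫) x
    pull []      = pair-zero w
    pull (_ ∷ _) = refl

  pair⊗-byHeadʳ : ∀ f (v : Lin Comp) β (H : ℕ → Comp → Comp → K) →
    ⟪ v ⊗ expandM f β ∣ (λ x y → byHead (λ b y′ → H b x y′) y) ⟫
      ≈ ∑Δ⁺ β (λ q t → f q * ⟪ v ⊗ expandM f t ∣ H (blockSum q) ⟫)
  pair⊗-byHeadʳ f v β H =
    trans (pair-cong v (λ x → pair-expandM-byHead f β (λ b y′ → H b x y′)))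
          (trans (pair-∑Δ⁺ v β _) (∑Δ⁺-cong β (λ b q t → pair-*ˡ (f (b ∷ q)) v _)))

  pair-expandM-εM : ∀ f α → ⟪ expandM f α ∣ εM ⟫ ≈ εM α
  pair-expandM-εM f []      = trans (+-identityʳ _) (trans (*-identityʳ _) (*-identityʳ _))
  pair-expandM-εM f (a ∷ α) = trans (pair-expandM f (a ∷ α) εM) (trans (∑-splittings-∷ a α _)
    (∑-zero (deconcatenations α) (λ ps → ∑-zero (splittings (proj₂ ps)) (λ bls → zeroʳ _))))

  leading : ℕ → (Comp → K) → Comp → K
  leading d φ = byHead (λ a γ → [ a ≐ d ] * φ γ)

  ≐ᶜ-∷ : ∀ d δ γ → [ γ ≐ᶜ d ∷ δ ] ≈ leading d (λ γ′ → [ γ′ ≐ᶜ δ ]) γ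
  ≐ᶜ-∷ d δ []      = refl
  ≐ᶜ-∷ d δ (_ ∷ _) = refl

  pair-expandM-leading : ∀ f (f̂ : Comp → K) → (∀ a γ → f̂ (a ∷ γ) ≈ f (a ∷ γ)) → ∀ d γ (φ : Comp → K) →
    ⟪ expandM f γ ∣ leading d φ ⟫ ≈ ∑Δ γ (λ r u → ([ size r ≐ suc d ] * f̂ r) * ⟪ expandM f u ∣ φ ⟫)
  pair-expandM-leading f f̂ f̂≈f d γ φ = begin
      ⟪ expandM f γ ∣ leading d φ ⟫
    ≈⟨ pair-expandM-byHead f γ _ ⟩
      ∑Δ⁺ γ (λ p s → f p * ⟪ expandM f s ∣ (λ γ′ → [ blockSum p ≐ d ] * φ γ′) ⟫)
    ≈⟨ ∑Δ⁺-cong γ (λ a p s → trans (*-cong (sym (f̂≈f a p)) (pair-*ˡ _ (expandM f s) φ)) (x∙yz≈yx∙z _ _ _)) ⟩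
      ∑Δ⁺ γ (λ r u → ([ size r ≐ suc d ] * f̂ r) * ⟪ expandM f u ∣ φ ⟫)
    ≈⟨ trans (+-cong (trans (*-cong (zeroˡ _) refl) (zeroˡ _)) refl) (+-identityˡ _) ⟨
      ([ 0 ≐ suc d ] * f̂ []) * ⟪ expandM f γ ∣ φ ⟫ + ∑Δ⁺ γ (λ r u → ([ size r ≐ suc d ] * f̂ r) * ⟪ expandM f u ∣ φ ⟫)
    ≈⟨ ∑Δ≈[]+∑Δ⁺ γ _ ⟨
      ∑Δ γ (λ r u → ([ size r ≐ suc d ] * f̂ r) * ⟪ expandM f u ∣ φ ⟫) ∎
    where open import Algebra.Properties.CommutativeSemigroup *-commutativeSemigroup using (x∙yz≈yx∙z)

  SatisfiesRecursion : (Comp → Comp → Comp → K) → (Comp → Comp → K) → Set ℓ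
  SatisfiesRecursion c κ =
    (∀ α β → c α β [] ≈ εM α * εM β) ×
    (∀ α β d δ → c α β (d ∷ δ) ≈ ∑Δ₂ α β (λ p s q t → ([ size p ℕ.+ size q ≐ suc d ] * κ p q) * c s t δ))

  AgreeInPositiveDegree : (κ₁ κ₂ : Comp → Comp → K) → Set ℓ
  AgreeInPositiveDegree κ₁ κ₂ = ∀ p q d → size p ℕ.+ size q ≡ suc d → κ₁ p q ≈ κ₂ p q

  module _ {c₁ c₂ : Comp → Comp → Comp → K} {κ₁ κ₂ : Comp → Comp → K}
           (rec₁ : SatisfiesRecursion c₁ κ₁) (rec₂ : SatisfiesRecursion c₂ κ₂) where

    recursion-unique : AgreeInPositiveDegree κ₁ κ₂ → ∀ δ α β → c₁ α β δ ≈ c₂ α β δ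
    recursion-unique κ₁≈κ₂ []      α β = trans (proj₁ rec₁ α β) (sym (proj₁ rec₂ α β))
    recursion-unique κ₁≈κ₂ (d ∷ δ) α β = trans (proj₂ rec₁ α β d δ)
      (trans (∑Δ₂-cong α β (λ p s q t → *-cong (leading-≈ p q) (recursion-unique κ₁≈κ₂ δ s t)))
             (sym (proj₂ rec₂ α β d δ)))
      where
      leading-≈ : ∀ p q → [ size p ℕ.+ size q ≐ suc d ] * κ₁ p q ≈ [ size p ℕ.+ size q ≐ suc d ] * κ₂ p q
      leading-≈ p q with size p ℕ.+ size q ℕ.≟ suc d
      ... | yes e = *-cong refl (κ₁≈κ₂ p q d e)
      ... | no ne = trans (trans (*-cong (≐-≢ ne) refl) (zeroˡ _)) (sym (trans (*-cong (≐-≢ ne) refl) (zeroˡ _)))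

  recursion-single : ∀ {c κ} → SatisfiesRecursion c κ → ∀ α β d → c α β (d ∷ []) ≈ [ size α ℕ.+ size β ≐ suc d ] * κ α β
  recursion-single {c} {κ} (base , step) α β d = begin
      c α β (d ∷ [])
    ≈⟨ step α β d [] ⟩
      ∑Δ α (λ p s → ∑Δ β (λ q t → k p q * c s t []))
    ≈⟨ ∑Δ₂-cong α β (λ p s q t → trans (*-cong refl (base s t)) (x∙yz≈xz∙y _ _ _)) ⟩
      ∑Δ α (λ p s → ∑Δ β (λ q t → (k p q * εM t) * εM s))
    ≈⟨ ∑Δ-cong α (λ p s → trans (sym (*-distribʳ-∑ _ (deconcatenations β) _)) (*-cong (∑Δ-εM β (k p)) refl)) ⟩
      ∑Δ α (λ p s → k p β * εM s)
    ≈⟨ ∑Δ-εM α (λ p → k p β) ⟩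
      k α β ∎
    where
    open import Algebra.Properties.CommutativeSemigroup *-commutativeSemigroup using (x∙yz≈xz∙y)
    k : Comp → Comp → K
    k p q = [ size p ℕ.+ size q ≐ suc d ] * κ p q

  recursion-kernel : ∀ {c₁ c₂ κ₁ κ₂} → SatisfiesRecursion c₁ κ₁ → SatisfiesRecursion c₂ κ₂ →
                     (∀ δ α β → c₁ α β δ ≈ c₂ α β δ) → AgreeInPositiveDegree κ₁ κ₂
  recursion-kernel {c₁} {c₂} {κ₁} {κ₂} rec₁ rec₂ c₁≈c₂ p q d e = begin
      κ₁ p q
    ≈⟨ trans (*-cong (≐-refl (suc d)) refl) (*-identityˡ _) ⟨
      [ suc d ≐ suc d ] * κ₁ p q
    ≡⟨ ≡.cong (λ n → [ n ≐ suc d ] * κ₁ p q) e ⟨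
      [ size p ℕ.+ size q ≐ suc d ] * κ₁ p q
    ≈⟨ recursion-single rec₁ p q d ⟨
      c₁ p q (d ∷ [])
    ≈⟨ c₁≈c₂ (d ∷ []) p q ⟩
      c₂ p q (d ∷ [])
    ≈⟨ recursion-single rec₂ p q d ⟩
      [ size p ℕ.+ size q ≐ suc d ] * κ₂ p q
    ≡⟨ ≡.cong (λ n → [ n ≐ suc d ] * κ₂ p q) e ⟩
      [ suc d ≐ suc d ] * κ₂ p q
    ≈⟨ trans (*-cong (≐-refl (suc d)) refl) (*-identityˡ _) ⟩
      κ₂ p q ∎

  agree-everywhere : ∀ {κ₁ κ₂ : Comp → Comp → K} → AgreeInPositiveDegree κ₁ κ₂ → κ₁ [] [] ≈ κ₂ [] [] → ∀ p q → κ₁ p q ≈ κ₂ p q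
  agree-everywhere agree e₀ []      []      = e₀
  agree-everywhere agree e₀ []      (b ∷ q) = agree [] (b ∷ q) (b ℕ.+ size q) ≡.refl
  agree-everywhere agree e₀ (a ∷ p) q       = agree (a ∷ p) q (a ℕ.+ size p ℕ.+ size q) ≡.refl

  module ShuffleLikeSums {S : Comp → Comp → List Comp} (isShuffleLike : IsShuffleLike S) where
    open IsShuffleLike isShuffleLike

    ∑-nilˡ : ∀ β (h : Comp → K) → ∑ (S [] β) h ≈ h β
    ∑-nilˡ β h = trans (reflexive (≡.cong (λ l → ∑ l h) (nilˡ β))) (+-identityʳ _)

    ∑-nilʳ : ∀ α (h : Comp → K) → ∑ (S α []) h ≈ h α
    ∑-nilʳ α h = trans (reflexive (≡.cong (λ l → ∑ l h) (nilʳ α))) (+-identityʳ _)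

    ∑-cons : ∀ a α b β (h : Comp → K) → ∑ (S (a ∷ α) (b ∷ β)) h ≈
               ∑ (S α (b ∷ β)) (λ γ → h (a ∷ γ))
                 + (∑ (S (a ∷ α) β) (λ γ → h (b ∷ γ)) + ∑ (diagonal a b) (λ c → ∑ (S α β) (λ γ → h (c ∷ γ))))
    ∑-cons a α b β h = trans (reflexive (≡.cong (λ l → ∑ l h) (cons a α b β)))
      (trans (∑-++ (map (a ∷_) (S α (b ∷ β))) _ h)
        (+-cong (reflexive (∑-map (a ∷_) (S α (b ∷ β)) h))
          (trans (∑-++ (map (b ∷_) (S (a ∷ α) β)) _ h)
            (+-cong (reflexive (∑-map (b ∷_) (S (a ∷ α) β) h))
              (trans (∑-concatMap _ (diagonal a b) h)
                (∑-cong (diagonal a b) (λ c → reflexive (∑-map (c ∷_) (S α β) h))))))))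

    ∑-εM : ∀ α β → ∑ (S α β) εM ≈ εM α * εM β
    ∑-εM []      β       = trans (∑-nilˡ β εM) (sym (*-identityˡ _))
    ∑-εM (a ∷ α) []      = trans (∑-nilʳ (a ∷ α) εM) (sym (zeroˡ _))
    ∑-εM (a ∷ α) (b ∷ β) = trans (∑-cons a α b β εM)
      (trans (+-cong (∑-zero (S α (b ∷ β)) (λ _ → refl))
                     (trans (+-cong (∑-zero (S (a ∷ α) β) (λ _ → refl))
                                    (∑-zero (diagonal a b) (λ _ → ∑-zero (S α β) (λ _ → refl))))
                            (+-identityˡ _)))
             (trans (+-identityˡ _) (sym (zeroˡ _))))

    ∑-size-≐ : ∀ α β n (h : Comp → K) →
               ∑ (S α β) (λ γ → [ size γ ≐ n ] * h γ) ≈ [ size α ℕ.+ size β ≐ n ] * ∑ (S α β) h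
    ∑-size-≐ α β n h = ∑-≐-const size n (S α β) h (size-∈ α β)

    ∑-diagonal-≐ : ∀ a b n (h : ℕ → K) →
                   ∑ (diagonal a b) (λ c → [ suc c ≐ n ] * h c) ≈ [ suc a ℕ.+ suc b ≐ n ] * ∑ (diagonal a b) h
    ∑-diagonal-≐ a b n h = ∑-≐-const suc n (diagonal a b) h (diagonal-size a b)

    ∑-byHead : ∀ α β (ψ : ℕ → Comp → K) → ∑ (S α β) (byHead ψ) ≈
      byHead (λ a α′ → ∑ (S α′ β) (ψ a)) α
        + (byHead (λ b β′ → ∑ (S α β′) (ψ b)) β
           + byHead (λ a α′ → byHead (λ b β′ → ∑ (diagonal a b) (λ c → ∑ (S α′ β′) (ψ c))) β) α)
    ∑-byHead []      []      ψ = trans (∑-nilˡ [] _) (sym (trans (+-identityˡ _) (+-identityˡ _)))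
    ∑-byHead []      (b ∷ β) ψ = trans (∑-nilˡ (b ∷ β) _)
      (sym (trans (+-identityˡ _) (trans (+-identityʳ _) (∑-nilˡ β (ψ b)))))
    ∑-byHead (a ∷ α) []      ψ = trans (∑-nilʳ (a ∷ α) _)
      (sym (trans (+-cong (∑-nilʳ α (ψ a)) (+-identityˡ _)) (+-identityʳ _)))
    ∑-byHead (a ∷ α) (b ∷ β) ψ = ∑-cons a α b β (byHead ψ)

    ∑S² : (Comp → Comp → K) → Comp → Comp → Comp → Comp → K
    ∑S² h p s q t = ∑ (S p q) (λ r → ∑ (S s t) (h r))

    private
      ∑-∑Δ-∷ : ∀ a γs (h : Comp → Comp → K) →
               ∑ γs (λ γ → ∑Δ (a ∷ γ) h) ≈ ∑ γs (λ γ → h [] (a ∷ γ)) + ∑ γs (λ γ → ∑Δ γ (λ p → h (a ∷ p)))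
      ∑-∑Δ-∷ a γs h = trans (∑-cong γs (λ γ → ∑Δ-∷ a γ h)) (∑-+ γs _ _)

      regroup : ∀ z₁ z₂ z₃ a b x y → (z₁ R.+ a) R.+ ((z₂ R.+ (b R.+ x)) R.+ (z₃ R.+ y))
                                      R.≈ ((z₁ R.+ (z₂ R.+ z₃)) R.+ b) R.+ (a R.+ (x R.+ y))
      regroup = solve-∀ ring-for-solver

      _∘∷_ : (Comp → Comp → K) → ℕ → Comp → Comp → K
      (h ∘∷ x) p = h (x ∷ p)

      -- The terms of both sides of ∑-∑Δ for leading parts a and b, sorted by which of
      -- α, β (or both, through a diagonal part c) the leading part of γ comes from.
      module ConsCons (a : ℕ) (α : Comp) (b : ℕ) (β : Comp) (h : Comp → Comp → K) where
        Z₁ Z₂ Z₃ : K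
        Z₁ = ∑ (S α (b ∷ β)) (λ γ → h [] (a ∷ γ))
        Z₂ = ∑ (S (a ∷ α) β) (λ γ → h [] (b ∷ γ))
        Z₃ = ∑ (diagonal a b) (λ c → ∑ (S α β) (λ γ → h [] (c ∷ γ)))
        U V : Comp → Comp → K
        U p s = ∑ (S s (b ∷ β)) (h (a ∷ p))
        V q t = ∑ (S (a ∷ α) t) (h (b ∷ q))
        C₁ C₂ C₃ : Comp → Comp → Comp → Comp → K
        C₁ p s q t = ∑ (S p (b ∷ q)) (λ r → ∑ (S s t) (h (a ∷ r)))
        C₂ p s q t = ∑ (S (a ∷ p) q) (λ r → ∑ (S s t) (h (b ∷ r)))
        C₃ p s q t = ∑ (diagonal a b) (λ c → ∑ (S p q) (λ r → ∑ (S s t) (h (c ∷ r))))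

        lhs : ∑ (S (a ∷ α) (b ∷ β)) (λ γ → ∑Δ γ h) ≈
          (Z₁ + ∑ (S α (b ∷ β)) (λ γ → ∑Δ γ (h ∘∷ a)))
            + ((Z₂ + ∑ (S (a ∷ α) β) (λ γ → ∑Δ γ (h ∘∷ b)))
               + (Z₃ + ∑ (diagonal a b) (λ c → ∑ (S α β) (λ γ → ∑Δ γ (h ∘∷ c)))))
        lhs = trans (∑-cons a α b β _)
          (+-cong (∑-∑Δ-∷ a (S α (b ∷ β)) h)
                  (+-cong (∑-∑Δ-∷ b (S (a ∷ α) β) h)
                          (trans (∑-cong (diagonal a b) (λ c → ∑-∑Δ-∷ c (S α β) h)) (∑-+ (diagonal a b) _ _))))

        rhs : ∑Δ₂ (a ∷ α) (b ∷ β) (∑S² h) ≈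
          ((Z₁ + (Z₂ + Z₃)) + ∑Δ β V)
            + (∑Δ α (λ p s → U p s + ∑Δ β (C₁ p s)) + (∑Δ α (λ p s → ∑Δ β (C₂ p s)) + ∑Δ α (λ p s → ∑Δ β (C₃ p s))))
        rhs = trans (∑Δ₂-split (a ∷ α) (b ∷ β) (∑S² h))
          (+-cong (+-cong (trans (∑-nilˡ [] _) (∑-cons a α b β (h []))) (∑Δ-cong β (λ q t → ∑-nilˡ (b ∷ q) _)))
                  (trans (∑Δ-cong α (λ p s → +-cong (∑-nilʳ (a ∷ p) _)
                                                    (trans (∑Δ-cong β (λ q t → ∑-cons a p b q _))
                                                           (trans (∑Δ-+ β _ _) (+-cong refl (∑Δ-+ β _ _))))))
                         (trans (∑Δ-cong α (λ p s → sym (+-assoc _ _ _)))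
                                (trans (∑Δ-+ α _ _) (+-cong refl (∑Δ-+ α _ _))))))

        from-α : ∑Δ₂ α (b ∷ β) (∑S² (h ∘∷ a)) ≈ ∑Δ α (λ p s → U p s + ∑Δ β (C₁ p s))
        from-α = ∑Δ-cong α (λ p s → trans (∑Δ-∷ b β _) (+-cong (∑-nilʳ p _) refl))

        from-β : ∑Δ₂ (a ∷ α) β (∑S² (h ∘∷ b)) ≈ ∑Δ β V + ∑Δ α (λ p s → ∑Δ β (C₂ p s))
        from-β = trans (∑Δ-∷ a α _) (+-cong (∑Δ-cong β (λ q t → ∑-nilˡ q _)) refl)

        from-diagonal : ∑ (diagonal a b) (λ c → ∑Δ₂ α β (∑S² (h ∘∷ c))) ≈ ∑Δ α (λ p s → ∑Δ β (C₃ p s))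
        from-diagonal = trans (∑-swap (diagonal a b) (deconcatenations α) _)
                              (∑Δ-cong α (λ p s → ∑-swap (diagonal a b) (deconcatenations β) _))

    -- deconcatenation is multiplicative for the product S
    ∑-∑Δ : ∀ α β (h : Comp → Comp → K) → ∑ (S α β) (λ γ → ∑Δ γ h) ≈ ∑Δ₂ α β (∑S² h)
    ∑-∑Δ []      β       h = trans (∑-nilˡ β _)
      (sym (trans (+-identityʳ _) (∑Δ-cong β (λ q t → trans (∑-nilˡ q _) (∑-nilˡ t (h q))))))
    ∑-∑Δ (a ∷ α) []      h = trans (∑-nilʳ (a ∷ α) _)
      (sym (∑Δ-cong (a ∷ α) (λ p s → trans (+-identityʳ _) (trans (∑-nilʳ p _) (∑-nilʳ s (h p))))))
    ∑-∑Δ (a ∷ α) (b ∷ β) h = begin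
        ∑ (S (a ∷ α) (b ∷ β)) (λ γ → ∑Δ γ h)
      ≈⟨ lhs ⟩
        (Z₁ + ∑ (S α (b ∷ β)) (λ γ → ∑Δ γ (h ∘∷ a)))
          + ((Z₂ + ∑ (S (a ∷ α) β) (λ γ → ∑Δ γ (h ∘∷ b)))
             + (Z₃ + ∑ (diagonal a b) (λ c → ∑ (S α β) (λ γ → ∑Δ γ (h ∘∷ c)))))
      ≈⟨ +-cong (+-cong refl (trans (∑-∑Δ α (b ∷ β) (h ∘∷ a)) from-α))
                (+-cong (+-cong refl (trans (∑-∑Δ (a ∷ α) β (h ∘∷ b)) from-β))
                        (+-cong refl (trans (∑-cong (diagonal a b) (λ c → ∑-∑Δ α β (h ∘∷ c))) from-diagonal))) ⟩
        (Z₁ + ∑Δ α (λ p s → U p s + ∑Δ β (C₁ p s)))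
          + ((Z₂ + (∑Δ β V + ∑Δ α (λ p s → ∑Δ β (C₂ p s)))) + (Z₃ + ∑Δ α (λ p s → ∑Δ β (C₃ p s))))
      ≈⟨ regroup _ _ _ _ _ _ _ ⟩
        ((Z₁ + (Z₂ + Z₃)) + ∑Δ β V)
          + (∑Δ α (λ p s → U p s + ∑Δ β (C₁ p s)) + (∑Δ α (λ p s → ∑Δ β (C₂ p s)) + ∑Δ α (λ p s → ∑Δ β (C₃ p s))))
      ≈⟨ rhs ⟨
        ∑Δ₂ (a ∷ α) (b ∷ β) (∑S² h) ∎
      where open ConsCons a α b β h

    pairTerms : (Comp → K) → Comp → Comp → (Comp → K) → K
    pairTerms f α β φ = ∑ (S α β) (λ γ → ⟪ expandM f γ ∣ φ ⟫)

    pairTerms-εM : ∀ f α β → pairTerms f α β εM ≈ εM α * εM β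
    pairTerms-εM f α β = trans (∑-cong (S α β) (pair-expandM-εM f)) (∑-εM α β)

    pairTerms-leading : ∀ f (f̂ : Comp → K) → (∀ a γ → f̂ (a ∷ γ) ≈ f (a ∷ γ)) → ∀ d α β (φ : Comp → K) →
      pairTerms f α β (leading d φ)
        ≈ ∑Δ₂ α β (λ p s q t → ([ size p ℕ.+ size q ≐ suc d ] * ∑ (S p q) f̂) * pairTerms f s t φ)
    pairTerms-leading f f̂ f̂≈f d α β φ = begin
        ∑ (S α β) (λ γ → ⟪ expandM f γ ∣ leading d φ ⟫)
      ≈⟨ ∑-cong (S α β) (λ γ → pair-expandM-leading f f̂ f̂≈f d γ φ) ⟩
        ∑ (S α β) (λ γ → ∑Δ γ h)
      ≈⟨ ∑-∑Δ α β h ⟩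
        ∑Δ₂ α β (∑S² h)
      ≈⟨ ∑Δ₂-cong α β (λ p s q t → trans (sym (∑-*-∑ (S p q) (S s t) _ _)) (*-cong (∑-size-≐ p q (suc d) f̂) refl)) ⟩
        ∑Δ₂ α β (λ p s q t → ([ size p ℕ.+ size q ≐ suc d ] * ∑ (S p q) f̂) * pairTerms f s t φ) ∎
      where
      h : Comp → Comp → K
      h r u = ([ size r ≐ suc d ] * f̂ r) * ⟪ expandM f u ∣ φ ⟫

    -- weight of a pair of leading blocks (p, q) in the leading part of a product term
    leadingWeight : (Comp → K) → Comp → Comp → K
    leadingWeight f []      []      = 0#
    leadingWeight f []      (b ∷ q) = f (b ∷ q)
    leadingWeight f (a ∷ p) []      = f (a ∷ p)
    leadingWeight f (a ∷ p) (b ∷ q) = ∑ (diagonal (blockSum (a ∷ p)) (blockSum (b ∷ q))) (λ _ → f (a ∷ p) * f (b ∷ q))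

    pairProduct : (Comp → K) → Comp → Comp → (Comp → K) → K
    pairProduct f α β φ = ⟪ expandM f α ⊗ expandM f β ∣ (λ x y → ∑ (S x y) φ) ⟫

    pairProduct-cong : ∀ f α β {φ φ′ : Comp → K} → (∀ γ → φ γ ≈ φ′ γ) → pairProduct f α β φ ≈ pairProduct f α β φ′
    pairProduct-cong f α β e = pair⊗-cong (expandM f α) (expandM f β) (λ x y → ∑-cong (S x y) e)

    pairProduct-*ˡ : ∀ f k α β (φ : Comp → K) →
      ⟪ expandM f α ⊗ expandM f β ∣ (λ x y → ∑ (S x y) (λ γ → k * φ γ)) ⟫ ≈ k * pairProduct f α β φ
    pairProduct-*ˡ f k α β φ =
      trans (pair⊗-cong (expandM f α) (expandM f β) (λ x y → sym (*-distribˡ-∑ k (S x y) φ))) (pair⊗-*ˡ k (expandM f α) (expandM f β) (λ x y → ∑ (S x y) φ))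

    pairProduct-εM : ∀ f α β → pairProduct f α β εM ≈ εM α * εM β
    pairProduct-εM f α β = trans (pair⊗-cong (expandM f α) (expandM f β) ∑-εM)
      (trans (pair⊗-* (expandM f α) (expandM f β) εM εM) (*-cong (pair-expandM-εM f α) (pair-expandM-εM f β)))

    private
      -- Splitting ∑ (S x y) (leading d φ) by whether the leading part of a term comes from x,
      -- from y, or from a diagonal merge of both (terms T₁, T₂, T₃).
      module LeadingPart (f : Comp → K) (d : ℕ) (φ : Comp → K) (α β : Comp) where
        open import Algebra.Properties.CommutativeSemigroup *-commutativeSemigroup
          using (x∙yz≈yx∙z) renaming (x∙yz≈y∙xz to *-exchange)
        E : Comp → QSym
        E = expandM f
        P : Comp → Comp → K
        P s t = pairProduct f s t φ
        ψ : ℕ → Comp → K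
        ψ c γ = [ c ≐ d ] * φ γ
        D : ℕ → ℕ → Comp → Comp → K
        D a b x′ y′ = ∑ (diagonal a b) (λ c → ∑ (S x′ y′) (ψ c))
        T₁ T₂ T₃ : Comp → Comp → K
        T₁ x y = byHead (λ a x′ → ∑ (S x′ y) (ψ a)) x
        T₂ x y = byHead (λ b y′ → ∑ (S x y′) (ψ b)) y
        T₃ x y = byHead (λ a x′ → byHead (λ b y′ → D a b x′ y′) y) x
        viaα viaβ : Comp → Comp → K
        viaα p s = f p * ([ blockSum p ≐ d ] * P s β)
        viaβ q t = f q * ([ blockSum q ≐ d ] * P α t)
        viaαβ : Comp → Comp → Comp → Comp → K
        viaαβ p s q t = f p * (f q * ∑ (diagonal (blockSum p) (blockSum q)) (λ c → [ c ≐ d ] * P s t))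
        term : Comp → Comp → Comp → Comp → K
        term p s q t = ([ size p ℕ.+ size q ≐ suc d ] * leadingWeight f p q) * P s t

        pair-T₁ : ⟪ E α ⊗ E β ∣ T₁ ⟫ ≈ ∑Δ⁺ α viaα
        pair-T₁ = trans (pair⊗-byHeadˡ f α (E β) (λ a x′ y → ∑ (S x′ y) (ψ a)))
                        (∑Δ⁺-cong α (λ a p s → *-cong refl (pairProduct-*ˡ f _ s β φ)))

        pair-T₂ : ⟪ E α ⊗ E β ∣ T₂ ⟫ ≈ ∑Δ⁺ β viaβ
        pair-T₂ = trans (pair⊗-byHeadʳ f (E α) β (λ b x y′ → ∑ (S x y′) (ψ b)))
                        (∑Δ⁺-cong β (λ b q t → *-cong refl (pairProduct-*ˡ f _ α t φ)))

        pair-T₃ : ⟪ E α ⊗ E β ∣ T₃ ⟫ ≈ ∑Δ⁺ α (λ p s → ∑Δ⁺ β (viaαβ p s))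
        pair-T₃ = begin
            ⟪ E α ⊗ E β ∣ T₃ ⟫
          ≈⟨ pair⊗-byHeadˡ f α (E β) _ ⟩
            ∑Δ⁺ α (λ p s → f p * ⟪ E s ⊗ E β ∣ (λ x′ y → byHead (λ b y′ → D (blockSum p) b x′ y′) y) ⟫)
          ≈⟨ ∑Δ⁺-cong α (λ a p s → *-cong refl (pair⊗-byHeadʳ f (E s) β _)) ⟩
            ∑Δ⁺ α (λ p s → f p * ∑Δ⁺ β (λ q t → f q * ⟪ E s ⊗ E t ∣ D (blockSum p) (blockSum q) ⟫))
          ≈⟨ ∑Δ⁺-cong α (λ a p s → *-cong refl (∑Δ⁺-cong β (λ b q t → *-cong refl
               (trans (pair⊗-∑ (E s) (E t) (diagonal _ _) _) (∑-cong (diagonal _ _) (λ c → pairProduct-*ˡ f _ s t φ)))))) ⟩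
            ∑Δ⁺ α (λ p s → f p * ∑Δ⁺ β (λ q t → f q * ∑ (diagonal (blockSum p) (blockSum q)) (λ c → [ c ≐ d ] * P s t)))
          ≈⟨ ∑Δ⁺-cong α (λ a p s → *-distribˡ-∑Δ⁺ β _ _) ⟩
            ∑Δ⁺ α (λ p s → ∑Δ⁺ β (viaαβ p s)) ∎

        term-∅∅ : term [] α [] β ≈ 0#
        term-∅∅ = trans (*-cong (zeroˡ _) refl) (zeroˡ _)

        term-∅∷ : ∀ b q t → term [] α (b ∷ q) t ≈ viaβ (b ∷ q) t
        term-∅∷ b q t = sym (x∙yz≈yx∙z _ _ _)

        term-∷∅ : ∀ a p s → term (a ∷ p) s [] β ≈ viaα (a ∷ p) s
        term-∷∅ a p s = trans (*-cong (*-cong (reflexive (≡.cong (λ n → [ n ≐ suc d ]) (ℕ.+-identityʳ (size (a ∷ p))))) refl) refl)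
                              (sym (x∙yz≈yx∙z _ _ _))

        term-∷∷ : ∀ a p s b q t → term (a ∷ p) s (b ∷ q) t ≈ viaαβ (a ∷ p) s (b ∷ q) t
        term-∷∷ a p s b q t = sym (begin
            f (a ∷ p) * (f (b ∷ q) * ∑ Δ (λ c → [ c ≐ d ] * P s t))
          ≈⟨ trans (*-cong refl (*-distribˡ-∑ _ Δ _)) (*-distribˡ-∑ _ Δ _) ⟩
            ∑ Δ (λ c → f (a ∷ p) * (f (b ∷ q) * ([ c ≐ d ] * P s t)))
          ≈⟨ ∑-cong Δ (λ c → trans (sym (*-assoc _ _ _)) (*-exchange _ _ _)) ⟩
            ∑ Δ (λ c → [ suc c ≐ suc d ] * ((f (a ∷ p) * f (b ∷ q)) * P s t))
          ≈⟨ ∑-diagonal-≐ (blockSum (a ∷ p)) (blockSum (b ∷ q)) (suc d) _ ⟩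
            [ size (a ∷ p) ℕ.+ size (b ∷ q) ≐ suc d ] * ∑ Δ (λ _ → (f (a ∷ p) * f (b ∷ q)) * P s t)
          ≈⟨ trans (*-cong refl (sym (*-distribʳ-∑ (P s t) Δ _))) (sym (*-assoc _ _ _)) ⟩
            term (a ∷ p) s (b ∷ q) t ∎)
          where
          Δ : List ℕ
          Δ = diagonal (blockSum (a ∷ p)) (blockSum (b ∷ q))

    pairProduct-leading : ∀ f d α β (φ : Comp → K) →
      pairProduct f α β (leading d φ)
        ≈ ∑Δ₂ α β (λ p s q t → ([ size p ℕ.+ size q ≐ suc d ] * leadingWeight f p q) * pairProduct f s t φ)
    pairProduct-leading f d α β φ = begin
        ⟪ E α ⊗ E β ∣ (λ x y → ∑ (S x y) (byHead ψ)) ⟫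
      ≈⟨ pair⊗-cong (E α) (E β) (λ x y → ∑-byHead x y ψ) ⟩
        ⟪ E α ⊗ E β ∣ (λ x y → T₁ x y + (T₂ x y + T₃ x y)) ⟫
      ≈⟨ trans (pair⊗-+ (E α) (E β) T₁ _) (+-cong refl (pair⊗-+ (E α) (E β) T₂ T₃)) ⟩
        ⟪ E α ⊗ E β ∣ T₁ ⟫ + (⟪ E α ⊗ E β ∣ T₂ ⟫ + ⟪ E α ⊗ E β ∣ T₃ ⟫)
      ≈⟨ +-cong pair-T₁ (+-cong pair-T₂ pair-T₃) ⟩
        ∑Δ⁺ α viaα + (∑Δ⁺ β viaβ + ∑Δ⁺ α (λ p s → ∑Δ⁺ β (viaαβ p s)))
      ≈⟨ trans (x∙yz≈y∙xz _ _ _) (sym (+-cong (+-identityˡ _) (∑Δ⁺-+ α viaα _))) ⟩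
        (0# + ∑Δ⁺ β viaβ) + ∑Δ⁺ α (λ p s → viaα p s + ∑Δ⁺ β (viaαβ p s))
      ≈⟨ +-cong (+-cong term-∅∅ (∑Δ⁺-cong β term-∅∷))
                (∑Δ⁺-cong α (λ a p s → +-cong (term-∷∅ a p s) (∑Δ⁺-cong β (term-∷∷ a p s)))) ⟨
        (term [] α [] β + ∑Δ⁺ β (term [] α)) + ∑Δ⁺ α (λ p s → term p s [] β + ∑Δ⁺ β (term p s))
      ≈⟨ ∑Δ₂-split α β term ⟨
        ∑Δ₂ α β term ∎
      where
      open LeadingPart f d φ α β
      open import Algebra.Properties.CommutativeSemigroup +-commutativeSemigroup using (x∙yz≈y∙xz)

    -- the coefficients of M_δ in E α ⋆ E β and in Σ_{γ ∈ α ⋆ β} E γ, where E = expandM f and ⋆ = S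
    productCoeff : (Comp → K) → Comp → Comp → Comp → K
    productCoeff f α β δ = pairProduct f α β (λ γ → [ γ ≐ᶜ δ ])

    termsCoeff : (Comp → K) → Comp → Comp → Comp → K
    termsCoeff f α β δ = pairTerms f α β (λ γ → [ γ ≐ᶜ δ ])

    productCoeff-recursion : ∀ f → SatisfiesRecursion (productCoeff f) (leadingWeight f)
    productCoeff-recursion f =
      (λ α β → trans (pairProduct-cong f α β ≐ᶜ-[]) (pairProduct-εM f α β)) ,
      (λ α β d δ → trans (pairProduct-cong f α β (≐ᶜ-∷ d δ)) (pairProduct-leading f d α β _))

    termsCoeff-recursion : ∀ f (f̂ : Comp → K) → (∀ a γ → f̂ (a ∷ γ) ≈ f (a ∷ γ)) →
                           SatisfiesRecursion (termsCoeff f) (λ p q → ∑ (S p q) f̂)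
    termsCoeff-recursion f f̂ f̂≈f =
      (λ α β → trans (∑-cong (S α β) (λ γ → pair-cong (expandM f γ) ≐ᶜ-[])) (pairTerms-εM f α β)) ,
      (λ α β d δ → trans (∑-cong (S α β) (λ γ → pair-cong (expandM f γ) (≐ᶜ-∷ d δ))) (pairTerms-leading f f̂ f̂≈f d α β _))


  module Sh = ShuffleLikeSums shuffles-isShuffleLike
  module QSh = ShuffleLikeSums quasiShuffles-isShuffleLike

  _[∅↦_] : (Comp → K) → K → Comp → K
  (f [∅↦ k ]) []      = k
  (f [∅↦ k ]) (a ∷ α) = f (a ∷ α)

  -- _·Sh_ and _·Q_ are extend₂ (unitTerms shuffles) and extend₂ (unitTerms quasiShuffles).
  unitTerms : (Comp → Comp → List Comp) → Comp → Comp → Lin Comp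
  unitTerms S α β = map (λ γ → (1# , γ)) (S α β)

  pair-extend₂-unitTerms : ∀ S (a b : Lin Comp) (φ : Comp → K) →
    ⟪ extend₂ (unitTerms S) a b ∣ φ ⟫ ≈ ⟪ a ⊗ b ∣ (λ x y → ∑ (S x y) φ) ⟫
  pair-extend₂-unitTerms S a b φ =
    trans (pair-extend₂ (unitTerms S) a b φ) (pair⊗-cong a b (λ x y → pair-unitCoefficients (S x y) φ))

  pair-extend₂-unitTerms-⇔ : ∀ S (φ : Comp → K) (Ψ : Comp → Comp → K) →
    (∀ a b → ⟪ extend₂ (unitTerms S) a b ∣ φ ⟫ ≈ ⟪ a ⊗ b ∣ Ψ ⟫) ⇔ (∀ p q → ∑ (S p q) φ ≈ Ψ p q)
  pair-extend₂-unitTerms-⇔ S φ Ψ = mk⇔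
    (λ h p q → begin
        ∑ (S p q) φ
      ≈⟨ trans (pair-extend₂-unitTerms S (basisVec p) (basisVec q) φ) (pair⊗-basisVec p q (λ x y → ∑ (S x y) φ)) ⟨
        ⟪ extend₂ (unitTerms S) (basisVec p) (basisVec q) ∣ φ ⟫
      ≈⟨ h (basisVec p) (basisVec q) ⟩
        ⟪ basisVec p ⊗ basisVec q ∣ Ψ ⟫
      ≈⟨ pair⊗-basisVec p q Ψ ⟩
        Ψ p q ∎)
    (λ h a b → trans (pair-extend₂-unitTerms S a b φ) (pair⊗-cong a b h))

  character⇔ : ∀ f → IsCharacterSh (fSh f) ⇔ (∀ p q → ∑ (shuffles p q) (f [∅↦ 1# ]) ≈ (f [∅↦ 1# ]) p * (f [∅↦ 1# ]) q)
  character⇔ f = mk⇔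
    (λ (mult , _) → Equivalence.to (pair-extend₂-unitTerms-⇔ shuffles f̃ _)
       (λ a b → trans (sym (fSh≈ (a ·Sh b))) (trans (mult a b) (trans (*-cong (fSh≈ a) (fSh≈ b)) (sym (pair⊗-* a b f̃ f̃))))))
    (λ h → (λ a b → trans (fSh≈ (a ·Sh b))
                      (trans (Equivalence.from (pair-extend₂-unitTerms-⇔ shuffles f̃ _) h a b)
                             (trans (pair⊗-* a b f̃ f̃) (sym (*-cong (fSh≈ a) (fSh≈ b)))))) ,
           trans (fSh≈ oneSh) (pair-basisVec [] f̃))
    where
    f̃ : Comp → K
    f̃ = f [∅↦ 1# ]
    fSh≈ : ∀ v → fSh f v ≈ ⟪ v ∣ f̃ ⟫
    fSh≈ v = pair-cong v (λ { [] → refl ; (_ ∷ _) → refl })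

  infinitesimalCharacter⇔ : ∀ g → IsInfinitesimalCharacterQSym (gQSym g) ⇔
    (∀ p q → ∑ (quasiShuffles p q) (g [∅↦ 0# ]) ≈ εM p * (g [∅↦ 0# ]) q + (g [∅↦ 0# ]) p * εM q)
  infinitesimalCharacter⇔ g = mk⇔
    (λ inf → Equivalence.to (pair-extend₂-unitTerms-⇔ quasiShuffles g₀ _)
       (λ a b → trans (sym (gQSym≈ (a ·Q b))) (trans (inf a b) (sym (split a b)))))
    (λ h a b → trans (gQSym≈ (a ·Q b)) (trans (Equivalence.from (pair-extend₂-unitTerms-⇔ quasiShuffles g₀ _) h a b) (split a b)))
    where
    g₀ : Comp → K
    g₀ = g [∅↦ 0# ]
    gQSym≈ : ∀ v → gQSym g v ≈ ⟪ v ∣ g₀ ⟫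
    gQSym≈ v = pair-cong v (λ { [] → refl ; (_ ∷ _) → refl })
    split : ∀ a b → ⟪ a ⊗ b ∣ (λ p q → εM p * g₀ q + g₀ p * εM q) ⟫ ≈ εQ a * gQSym g b + gQSym g a * εQ b
    split a b = trans (pair⊗-+ a b _ _) (+-cong (trans (pair⊗-* a b εM g₀) (*-cong refl (sym (gQSym≈ b))))
                                                (trans (pair⊗-* a b g₀ εM) (*-cong (sym (gQSym≈ a)) refl)))

  leadingWeight-quasiShuffles : ∀ f → AgreeInPositiveDegree (QSh.leadingWeight f) (λ p q → (f [∅↦ 1# ]) p * (f [∅↦ 1# ]) q)
  leadingWeight-quasiShuffles f []      (b ∷ q) d _ = sym (*-identityˡ _)
  leadingWeight-quasiShuffles f (a ∷ p) []      d _ = sym (*-identityʳ _)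
  leadingWeight-quasiShuffles f (a ∷ p) (b ∷ q) d _ = +-identityʳ _

  leadingWeight-shuffles : ∀ g p q → Sh.leadingWeight g p q ≈ εM p * (g [∅↦ 0# ]) q + (g [∅↦ 0# ]) p * εM q
  leadingWeight-shuffles g []      []      = sym (trans (+-cong (zeroʳ _) (zeroˡ _)) (+-identityʳ _))
  leadingWeight-shuffles g []      (b ∷ q) = sym (trans (+-cong (*-identityˡ _) (zeroˡ _)) (+-identityʳ _))
  leadingWeight-shuffles g (a ∷ p) []      = sym (trans (+-cong (zeroˡ _) (*-identityʳ _)) (+-identityˡ _))
  leadingWeight-shuffles g (a ∷ p) (b ∷ q) = sym (trans (+-cong (zeroˡ _) (zeroʳ _)) (+-identityʳ _))

  character⇔kernels : ∀ f → IsCharacterSh (fSh f) ⇔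
    AgreeInPositiveDegree (QSh.leadingWeight f) (λ p q → ∑ (shuffles p q) (f [∅↦ 1# ]))
  character⇔kernels f = mk⇔
    (λ ch p q d e → trans (leadingWeight-quasiShuffles f p q d e) (sym (Equivalence.to (character⇔ f) ch p q)))
    (λ agree → Equivalence.from (character⇔ f) (λ p q → sym (agree-everywhere
      (λ p q d e → trans (sym (leadingWeight-quasiShuffles f p q d e)) (agree p q d e))
      (trans (*-identityˡ _) (sym (+-identityʳ _))) p q)))

  infinitesimalCharacter⇔kernels : ∀ g → IsInfinitesimalCharacterQSym (gQSym g) ⇔
    AgreeInPositiveDegree (λ p q → ∑ (quasiShuffles p q) (g [∅↦ 0# ])) (Sh.leadingWeight g)
  infinitesimalCharacter⇔kernels g = mk⇔
    (λ inf p q d e → trans (Equivalence.to (infinitesimalCharacter⇔ g) inf p q) (sym (leadingWeight-shuffles g p q)))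
    (λ agree → Equivalence.from (infinitesimalCharacter⇔ g) (agree-everywhere
      (λ p q d e → trans (agree p q d e) (leadingWeight-shuffles g p q))
      (trans (+-identityʳ _) (sym (trans (+-cong (zeroʳ _) (zeroˡ _)) (+-identityʳ _))))))

  character⇔coefficients : ∀ f → IsCharacterSh (fSh f) ⇔ (∀ δ α β → QSh.productCoeff f α β δ ≈ Sh.termsCoeff f α β δ)
  character⇔coefficients f = mk⇔
    (λ ch → recursion-unique recₗ recᵣ (Equivalence.to (character⇔kernels f) ch))
    (λ coeffs → Equivalence.from (character⇔kernels f) (recursion-kernel recₗ recᵣ coeffs))
    where
    recₗ : SatisfiesRecursion (QSh.productCoeff f) (QSh.leadingWeight f)
    recₗ = QSh.productCoeff-recursion f
    recᵣ : SatisfiesRecursion (Sh.termsCoeff f) (λ p q → ∑ (shuffles p q) (f [∅↦ 1# ]))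
    recᵣ = Sh.termsCoeff-recursion f (f [∅↦ 1# ]) (λ _ _ → refl)

  infinitesimalCharacter⇔coefficients : ∀ g → IsInfinitesimalCharacterQSym (gQSym g) ⇔
    (∀ δ α β → QSh.termsCoeff g α β δ ≈ Sh.productCoeff g α β δ)
  infinitesimalCharacter⇔coefficients g = mk⇔
    (λ inf → recursion-unique recₗ recᵣ (Equivalence.to (infinitesimalCharacter⇔kernels g) inf))
    (λ coeffs → Equivalence.from (infinitesimalCharacter⇔kernels g) (recursion-kernel recₗ recᵣ coeffs))
    where
    recₗ : SatisfiesRecursion (QSh.termsCoeff g) (λ p q → ∑ (quasiShuffles p q) (g [∅↦ 0# ]))
    recₗ = QSh.termsCoeff-recursion g (g [∅↦ 0# ]) (λ _ _ → refl)
    recᵣ : SatisfiesRecursion (Sh.productCoeff g) (Sh.leadingWeight g)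
    recᵣ = Sh.productCoeff-recursion g

  coeff-extend : ∀ (ψ : Comp → Lin Comp) v δ → coeff _≟C_ (extend ψ v) δ ≈ ⟪ v ∣ (λ z → coeff _≟C_ (ψ z) δ) ⟫
  coeff-extend ψ v δ = trans (coeff≈pair (extend ψ v) δ)
    (trans (pair-extend ψ v _) (pair-cong v (λ z → sym (coeff≈pair (ψ z) δ))))

  coeff-basisVec : ∀ γ δ → coeff _≟C_ (basisVec γ) δ ≈ [ γ ≐ᶜ δ ]
  coeff-basisVec γ δ = trans (coeff≈pair (basisVec γ) δ) (pair-basisVec γ (λ γ′ → [ γ′ ≐ᶜ δ ]))

  -- ψ : Comp → Lin Comp stands for the linear map x_γ ↦ ψ γ, applied by extend ψ.
  IsRightInverse : (ψ φ : Comp → Lin Comp) → Set ℓ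
  IsRightInverse ψ φ = ∀ γ → extend ψ (φ γ) ≈Q basisVec γ

  Multiplicative : (ψ : Comp → Lin Comp) (μ₁ μ₂ : Comp → Comp → Lin Comp) → Set ℓ
  Multiplicative ψ μ₁ μ₂ = ∀ x y → extend ψ (μ₁ x y) ≈Q extend₂ μ₂ (ψ x) (ψ y)

  multiplicative-bilinear : ∀ {ψ μ₁ μ₂} → Multiplicative ψ μ₁ μ₂ → ∀ a b (Θ : Comp → K) →
    ⟪ extend₂ μ₂ (extend ψ a) (extend ψ b) ∣ Θ ⟫ ≈ ⟪ extend ψ (extend₂ μ₁ a b) ∣ Θ ⟫
  multiplicative-bilinear {ψ} {μ₁} {μ₂} mult a b Θ = begin
      ⟪ extend₂ μ₂ (extend ψ a) (extend ψ b) ∣ Θ ⟫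
    ≈⟨ pair-extend₂ μ₂ (extend ψ a) (extend ψ b) Θ ⟩
      ⟪ extend ψ a ⊗ extend ψ b ∣ (λ u v → ⟪ μ₂ u v ∣ Θ ⟫) ⟫
    ≈⟨ trans (pair-extend ψ a _) (pair-cong a (λ x → pair-cong (ψ x) (λ u → pair-extend ψ b _))) ⟩
      ⟪ a ∣ (λ x → ⟪ ψ x ∣ (λ u → ⟪ b ∣ (λ y → ⟪ ψ y ∣ (λ v → ⟪ μ₂ u v ∣ Θ ⟫) ⟫) ⟫) ⟫) ⟫
    ≈⟨ pair-cong a (λ x → pair-swap (ψ x) b _) ⟩
      ⟪ a ⊗ b ∣ (λ x y → ⟪ ψ x ⊗ ψ y ∣ (λ u v → ⟪ μ₂ u v ∣ Θ ⟫) ⟫) ⟫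
    ≈⟨ pair⊗-cong a b (λ x y → trans (sym (pair-extend₂ μ₂ (ψ x) (ψ y) Θ))
                         (trans (pair-resp-≈Q (extend₂ μ₂ (ψ x) (ψ y)) (extend ψ (μ₁ x y)) Θ (λ δ → sym (mult x y δ))) (pair-extend ψ (μ₁ x y) Θ))) ⟩
      ⟪ a ⊗ b ∣ (λ x y → ⟪ μ₁ x y ∣ (λ z → ⟪ ψ z ∣ Θ ⟫) ⟫) ⟫
    ≈⟨ trans (pair-extend ψ (extend₂ μ₁ a b) Θ) (pair-extend₂ μ₁ a b _) ⟨
      ⟪ extend ψ (extend₂ μ₁ a b) ∣ Θ ⟫ ∎

  multiplicative-inverse : ∀ {ψ φ μ₁ μ₂} → IsRightInverse ψ φ → IsRightInverse φ ψ →
                           Multiplicative ψ μ₁ μ₂ → Multiplicative φ μ₂ μ₁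
  multiplicative-inverse {ψ} {φ} {μ₁} {μ₂} ψφ≈id φψ≈id mult x y δ = begin
      coeff _≟C_ (extend φ (μ₂ x y)) δ
    ≈⟨ coeff-extend φ (μ₂ x y) δ ⟩
      ⟪ μ₂ x y ∣ Θ ⟫
    ≈⟨ trans (pair-extend₂ μ₂ (basisVec x) (basisVec y) Θ) (pair⊗-basisVec x y (λ u v → ⟪ μ₂ u v ∣ Θ ⟫)) ⟨
      ⟪ extend₂ μ₂ (basisVec x) (basisVec y) ∣ Θ ⟫
    ≈⟨ trans (pair-extend₂ μ₂ (basisVec x) (basisVec y) Θ)
        (trans (pair-resp-≈Q (basisVec x) (extend ψ (φ x)) (λ u → ⟪ basisVec y ∣ (λ v → ⟪ μ₂ u v ∣ Θ ⟫) ⟫) (λ δ′ → sym (ψφ≈id x δ′)))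
          (trans (pair-cong (extend ψ (φ x)) (λ u → pair-resp-≈Q (basisVec y) (extend ψ (φ y)) (λ v → ⟪ μ₂ u v ∣ Θ ⟫) (λ δ′ → sym (ψφ≈id y δ′))))
                 (sym (pair-extend₂ μ₂ (extend ψ (φ x)) (extend ψ (φ y)) Θ)))) ⟩
      ⟪ extend₂ μ₂ (extend ψ (φ x)) (extend ψ (φ y)) ∣ Θ ⟫
    ≈⟨ multiplicative-bilinear mult (φ x) (φ y) Θ ⟩
      ⟪ extend ψ (extend₂ μ₁ (φ x) (φ y)) ∣ Θ ⟫
    ≈⟨ pair-extend ψ (extend₂ μ₁ (φ x) (φ y)) Θ ⟩
      ⟪ extend₂ μ₁ (φ x) (φ y) ∣ (λ z → ⟪ ψ z ∣ Θ ⟫) ⟫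
    ≈⟨ pair-cong (extend₂ μ₁ (φ x) (φ y))
                 (λ z → trans (sym (coeff-extend φ (ψ z) δ)) (trans (φψ≈id z δ) (coeff-basisVec z δ))) ⟩
      ⟪ extend₂ μ₁ (φ x) (φ y) ∣ (λ z → [ z ≐ᶜ δ ]) ⟫
    ≈⟨ coeff≈pair (extend₂ μ₁ (φ x) (φ y)) δ ⟨
      coeff _≟C_ (extend₂ μ₁ (φ x) (φ y)) δ ∎
    where
    Θ : Comp → K
    Θ z = coeff _≟C_ (φ z) δ

  combX-injective : ∀ {X} → LinIndependent X → ∀ u v → combX X u ≈Q combX X v → u ≈Q v
  combX-injective {X} independent u v Xu≈Xv δ = x∙y⁻¹≈ε⇒x≈y _ _ (begin
      coeff _≟C_ u δ - coeff _≟C_ v δ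
    ≈⟨ +-cong refl (-1*x≈-x _) ⟨
      coeff _≟C_ u δ + - 1# * coeff _≟C_ v δ
    ≈⟨ +-cong (coeff≈pair u δ) (*-cong refl (coeff≈pair v δ)) ⟩
      ⟪ u ∣ (λ z → [ z ≐ᶜ δ ]) ⟫ + - 1# * ⟪ v ∣ (λ z → [ z ≐ᶜ δ ]) ⟫
    ≈⟨ trans (pair-++ u (scale (- 1#) v) _) (+-cong refl (pair-scale (- 1#) v _)) ⟨
      ⟪ u ++ scale (- 1#) v ∣ (λ z → [ z ≐ᶜ δ ]) ⟫
    ≈⟨ coeff≈pair (u ++ scale (- 1#) v) δ ⟨
      coeff _≟C_ (u ++ scale (- 1#) v) δ
    ≈⟨ independent (u ++ scale (- 1#) v) vanishes δ ⟩
      0# ∎)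
    where
    open import Algebra.Properties.Ring ring using (-1*x≈-x)
    open import Algebra.Properties.Group +-group using (x∙y⁻¹≈ε⇒x≈y)
    vanishes : combX X (u ++ scale (- 1#) v) ≈Q zeroL
    vanishes δ′ = begin
        coeff _≟C_ (combX X (u ++ scale (- 1#) v)) δ′
      ≈⟨ trans (coeff-extend X (u ++ scale (- 1#) v) δ′) (trans (pair-++ u (scale (- 1#) v) Θ) (+-cong refl (pair-scale (- 1#) v Θ))) ⟩
        ⟪ u ∣ (λ z → coeff _≟C_ (X z) δ′) ⟫ + - 1# * ⟪ v ∣ (λ z → coeff _≟C_ (X z) δ′) ⟫
      ≈⟨ +-cong (sym (coeff-extend X u δ′)) (*-cong refl (sym (coeff-extend X v δ′))) ⟩
        coeff _≟C_ (combX X u) δ′ + - 1# * coeff _≟C_ (combX X v) δ′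
      ≈⟨ +-cong (Xu≈Xv δ′) (-1*x≈-x _) ⟩
        coeff _≟C_ (combX X v) δ′ - coeff _≟C_ (combX X v) δ′
      ≈⟨ -‿inverseʳ _ ⟩
        0# ∎
      where
      Θ : Comp → K
      Θ z = coeff _≟C_ (X z) δ′

  rightInverse-swap : ∀ {X G} → LinIndependent X → IsRightInverse X G → IsRightInverse G X
  rightInverse-swap {X} {G} independent XG≈id γ = combX-injective independent (extend G (X γ)) (basisVec γ) (λ δ → begin
      coeff _≟C_ (extend X (extend G (X γ))) δ
    ≈⟨ trans (coeff-extend X (extend G (X γ)) δ) (pair-extend G (X γ) (λ z → coeff _≟C_ (X z) δ)) ⟩
      ⟪ X γ ∣ (λ z′ → ⟪ G z′ ∣ (λ z → coeff _≟C_ (X z) δ) ⟫) ⟫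
    ≈⟨ pair-cong (X γ) (λ z′ → trans (sym (coeff-extend X (G z′) δ)) (trans (XG≈id z′ δ) (coeff-basisVec z′ δ))) ⟩
      ⟪ X γ ∣ (λ z′ → [ z′ ≐ᶜ δ ]) ⟫
    ≈⟨ trans (coeff-extend X (basisVec γ) δ) (trans (pair-basisVec γ (λ z → coeff _≟C_ (X z) δ)) (coeff≈pair (X γ) δ)) ⟨
      coeff _≟C_ (extend X (basisVec γ)) δ ∎)

  multiplicative-inverse⇔ : ∀ {ψ φ μ₁ μ₂} → IsRightInverse ψ φ → IsRightInverse φ ψ →
                            Multiplicative ψ μ₁ μ₂ ⇔ Multiplicative φ μ₂ μ₁
  multiplicative-inverse⇔ {ψ} {φ} {μ₁} {μ₂} ψφ≈id φψ≈id =
    mk⇔ (multiplicative-inverse {ψ} {φ} {μ₁} {μ₂} ψφ≈id φψ≈id) (multiplicative-inverse {φ} {ψ} {μ₂} {μ₁} φψ≈id ψφ≈id)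

  coeff-extend-unitTerms : ∀ (ψ : Comp → Lin Comp) S α β δ →
    coeff _≟C_ (extend ψ (unitTerms S α β)) δ ≈ ∑ (S α β) (λ γ → ⟪ ψ γ ∣ (λ z → [ z ≐ᶜ δ ]) ⟫)
  coeff-extend-unitTerms ψ S α β δ = trans (coeff-extend ψ (unitTerms S α β) δ)
    (trans (pair-unitCoefficients (S α β) _) (∑-cong (S α β) (λ γ → coeff≈pair (ψ γ) δ)))

  coeff-extend₂-unitTerms : ∀ S (v w : Lin Comp) δ →
    coeff _≟C_ (extend₂ (unitTerms S) v w) δ ≈ ⟪ v ⊗ w ∣ (λ x y → ∑ (S x y) (λ z → [ z ≐ᶜ δ ])) ⟫
  coeff-extend₂-unitTerms S v w δ =
    trans (coeff≈pair (extend₂ (unitTerms S) v w) δ) (pair-extend₂-unitTerms S v w _)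

  expandM-multiplicative⇔coefficients : ∀ g →
    Multiplicative (expandM g) (unitTerms quasiShuffles) (unitTerms shuffles)
      ⇔ (∀ δ α β → QSh.termsCoeff g α β δ ≈ Sh.productCoeff g α β δ)
  expandM-multiplicative⇔coefficients g = mk⇔
    (λ mult δ α β → trans (sym (coeff-extend-unitTerms (expandM g) quasiShuffles α β δ))
                          (trans (mult α β δ) (coeff-extend₂-unitTerms shuffles (expandM g α) (expandM g β) δ)))
    (λ coeffs α β δ → trans (coeff-extend-unitTerms (expandM g) quasiShuffles α β δ)
                            (trans (coeffs δ α β) (sym (coeff-extend₂-unitTerms shuffles (expandM g α) (expandM g β) δ))))

  module _ (X : Comp → QSym) (f : Comp → K) (X≈expandM : ∀ α → X α ≈Q expandM f α) where

    private
      pair-X : ∀ γ (φ : Comp → K) → ⟪ X γ ∣ φ ⟫ ≈ ⟪ expandM f γ ∣ φ ⟫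
      pair-X γ φ = pair-resp-≈Q (X γ) (expandM f γ) φ (X≈expandM γ)

      coeff-X-product : ∀ α β δ → coeff _≟C_ (X α ·Q X β) δ ≈ QSh.productCoeff f α β δ
      coeff-X-product α β δ = trans (coeff-extend₂-unitTerms quasiShuffles (X α) (X β) δ)
        (trans (pair-cong (X α) (λ x → pair-X β _)) (pair-X α _))

      coeff-X-terms : ∀ α β δ → coeff _≟C_ (extend X (unitTerms shuffles α β)) δ ≈ Sh.termsCoeff f α β δ
      coeff-X-terms α β δ = trans (coeff-extend-unitTerms X shuffles α β δ) (∑-cong (shuffles α β) (λ γ → pair-X γ _))

      coeff-X-sum : ∀ α β δ → coeff _≟C_ (sumL (map X (shuffles α β))) δ ≈ Sh.termsCoeff f α β δ
      coeff-X-sum α β δ = begin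
          coeff _≟C_ (sumL (map X (shuffles α β))) δ
        ≈⟨ trans (coeff≈pair (sumL (map X (shuffles α β))) δ) (pair-sumL (map X (shuffles α β)) _) ⟩
          ∑ (map X (shuffles α β)) (λ v → ⟪ v ∣ (λ z → [ z ≐ᶜ δ ]) ⟫)
        ≡⟨ ∑-map X (shuffles α β) _ ⟩
          ∑ (shuffles α β) (λ γ → ⟪ X γ ∣ (λ z → [ z ≐ᶜ δ ]) ⟫)
        ≈⟨ ∑-cong (shuffles α β) (λ γ → pair-X γ _) ⟩
          Sh.termsCoeff f α β δ ∎

    shuffleProducts⇔coefficients :
      (∀ α β → (X α ·Q X β) ≈Q sumL (map X (shuffles α β)))
        ⇔ (∀ δ α β → QSh.productCoeff f α β δ ≈ Sh.termsCoeff f α β δ)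
    shuffleProducts⇔coefficients = mk⇔
      (λ prod δ α β → trans (sym (coeff-X-product α β δ)) (trans (prod α β δ) (coeff-X-sum α β δ)))
      (λ coeffs α β δ → trans (coeff-X-product α β δ) (trans (coeffs δ α β) (sym (coeff-X-sum α β δ))))

    multiplicative⇔coefficients :
      Multiplicative X (unitTerms shuffles) (unitTerms quasiShuffles)
        ⇔ (∀ δ α β → QSh.productCoeff f α β δ ≈ Sh.termsCoeff f α β δ)
    multiplicative⇔coefficients = mk⇔
      (λ mult δ α β → trans (sym (coeff-X-product α β δ)) (trans (sym (mult α β δ)) (coeff-X-terms α β δ)))
      (λ coeffs α β δ → trans (coeff-X-terms α β δ) (trans (sym (coeffs δ α β)) (sym (coeff-X-product α β δ))))

    expandM-rightInverse : ∀ g → (∀ α → M α ≈Q expandX X g α) → IsRightInverse X (expandM g)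
    expandM-rightInverse g M≈expandX γ δ = begin
        coeff _≟C_ (extend X (expandM g γ)) δ
      ≈⟨ trans (coeff-extend X (expandM g γ) δ) (pair-expandM g γ _) ⟩
        ∑ (splittings γ) (λ bls → blockProd g bls * coeff _≟C_ (X (coarsening bls)) δ)
      ≈⟨ ∑-cong (splittings γ) (λ bls → *-cong refl (coeff≈pair (X (coarsening bls)) δ)) ⟩
        ∑ (splittings γ) (λ bls → blockProd g bls * ⟪ X (coarsening bls) ∣ (λ z → [ z ≐ᶜ δ ]) ⟫)
      ≈⟨ trans (coeff≈pair (expandX X g γ) δ) (pair-expandX X g γ _) ⟨
        coeff _≟C_ (expandX X g γ) δ
      ≈⟨ M≈expandX γ δ ⟨
        coeff _≟C_ (M γ) δ ∎

theorem4p5 : ∀ {c ℓ : Level} (F : Field c ℓ) → let open LinearAlgebra F in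
    (X : Comp → QSym) (f g : Comp → K) →
    IsDeconcatenationBasis X →
    Nonsingular f → Nonsingular g →
    (∀ α → X α ≈Q expandM f α) →
    (∀ α → M α ≈Q expandX X g α) →
    (IsShuffleBasis X ⇔ IsCharacterSh (fSh f))
      × (IsCharacterSh (fSh f) ⇔ IsInfinitesimalCharacterQSym (gQSym g))
theorem4p5 F X f g deconcatenationBasis _ _ X≈expandM M≈expandX =
  ⇔-trans shuffleBasis⇔shuffleProducts
    (⇔-trans (shuffleProducts⇔coefficients F X f X≈expandM) (⇔-sym (character⇔coefficients F f))) ,
  ⇔-trans (character⇔coefficients F f)
    (⇔-trans (⇔-sym (multiplicative⇔coefficients F X f X≈expandM))
      (⇔-trans (multiplicative-inverse⇔ F {μ₁ = unitTerms F shuffles} {μ₂ = unitTerms F quasiShuffles} XG≈id GX≈id)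
        (⇔-trans (expandM-multiplicative⇔coefficients F g) (⇔-sym (infinitesimalCharacter⇔coefficients F g)))))
  where
  open LinearAlgebra F
  shuffleBasis⇔shuffleProducts : IsShuffleBasis X ⇔ (∀ α β → (X α ·Q X β) ≈Q sumL (map X (shuffles α β)))
  shuffleBasis⇔shuffleProducts = mk⇔ proj₂ (deconcatenationBasis ,_)
  XG≈id : IsRightInverse F X (expandM g)
  XG≈id = expandM-rightInverse F X f X≈expandM g M≈expandX
  GX≈id : IsRightInverse F (expandM g) X
  GX≈id = rightInverse-swap F (proj₂ (proj₂ (proj₁ deconcatenationBasis))) XG≈id
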